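{- Let $p$ be a prime with $p\equiv 1\pmod 3$, write $p=x^2+3y^2$ with integers $x,y$, let $\chi$ be a character of $\mathbb{F}_p$ of order $3$ and $\phi$ the quadratic character. Then $$p\cdot \mathrm{Re}\left[{\chi \choose \chi}+{\phi\chi \choose \chi}\right]=(-1)^{x+y}\left(\frac{x}{3}\right)\cdot x-1,$$ where $\left(\frac{x}{3}\right)$ is the Legendre symbol.
   Context: Characters of $\mathbb{F}_p^\times$ are extended to $\mathbb{F}_p$ by $\chi(0)=0$; $\overline{B}$ is the inverse character, and for characters $A,B$, ${A\choose B}:=\frac{B(-1)}{p}\sum_{x\in\mathbb{F}_p}A(x)\overline{B}(1-x)$. -}

module Defs where

open import Data.Nat as ℕ using (ℕ; zero; suc; NonZero; _∸_; _<_; _≤_)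
open import Data.Nat.DivMod using (_mod_; _%_)
open import Data.Fin using (Fin; toℕ)
open import Data.Fin.Base using (module Fin)
open import Data.Integer as ℤ using (ℤ; +_; -_)
open import Data.Integer.DivMod using (_%ℕ_)
open import Data.Rational as ℚ using (ℚ; ½)
open import Data.Product using (Σ; _×_)
open import Relation.Binary.PropositionalEquality using (_≡_)
open import Relation.Nullary using (¬_)

-- Eisenstein integers  a + b ω  with ω = e^{2πi/3}, ω² = -1 - ω.
-- All values of characters of order 2, 3, 6 of F_p^× lie in ℤ[ω] ⊂ ℂ.
record ℤω : Set where
  constructor _+_ω
  field
    a : ℤ
    b : ℤ
open ℤω public

0ω 1ω : ℤω
0ω = (+ 0) + (+ 0) ω
1ω = (+ 1) + (+ 0) ω

_⊕_ : ℤω → ℤω → ℤω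
(x + y ω) ⊕ (u + v ω) = (x ℤ.+ u) + (y ℤ.+ v) ω

-- (x + yω)(u + vω) = xu + (xv + yu)ω + yv ω² = (xu - yv) + (xv + yu - yv)ω
_⊗_ : ℤω → ℤω → ℤω
(x + y ω) ⊗ (u + v ω) =
  (x ℤ.* u ℤ.- y ℤ.* v) + (x ℤ.* v ℤ.+ y ℤ.* u ℤ.- y ℤ.* v) ω

-- complex conjugation: conj(x + yω) = x + yω² = (x - y) - yω
conj : ℤω → ℤω
conj (x + y ω) = (x ℤ.- y) + (ℤ.- y) ω

_^ω_ : ℤω → ℕ → ℤω
z ^ω zero = 1ω
z ^ω suc n = z ⊗ (z ^ω n)

-- Real part (in ℚ) of an element of ℚ(ω): Re(x + yω) = x - y/2
Re : ℚ → ℚ → ℚ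
Re x y = x ℚ.- y ℚ.* ½

Σω : (n : ℕ) → (Fin n → ℤω) → ℤω
Σω zero f = 0ω
Σω (suc n) f = f Fin.zero ⊕ Σω n (λ i → f (Fin.suc i))

-- F_p is modelled as Fin p with arithmetic mod p.
module _ (p : ℕ) .{{_ : NonZero p}} where

  zeroF oneF minusOneF : Fin p
  zeroF = 0 mod p
  oneF = 1 mod p
  minusOneF = (p ∸ 1) mod p

  _·F_ : Fin p → Fin p → Fin p
  x ·F y = (toℕ x ℕ.* toℕ y) mod p

  oneMinus : Fin p → Fin p
  oneMinus x = ((1 ℕ.+ p) ∸ toℕ x) mod p

  record IsCharacter (χ : Fin p → ℤω) : Set where
    field
      at-zero : χ zeroF ≡ 0ω
      at-one  : χ oneF ≡ 1ω
      mult    : ∀ x y → χ (x ·F y) ≡ χ x ⊗ χ y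

  record IsCharacterOfOrder (k : ℕ) (χ : Fin p → ℤω) : Set where
    field
      isChar   : IsCharacter χ
      pow-k    : ∀ x → ¬ (x ≡ zeroF) → χ x ^ω k ≡ 1ω
      minimal  : ∀ d → 1 ≤ d → d < k → Σ (Fin p) λ x → ¬ (x ≡ zeroF) × ¬ (χ x ^ω d ≡ 1ω)

  -- inverse character: B̄(x) = conj(B(x)) (B(x) a root of unity), B̄(0) = 0
  inv : (Fin p → ℤω) → (Fin p → ℤω)
  inv B x = conj (B x)

  -- p · (A choose B) = B(-1) Σ_x A(x) B̄(1-x)   (an element of ℤ[ω])
  pBinom : (Fin p → ℤω) → (Fin p → ℤω) → ℤω
  pBinom A B = B minusOneF ⊗ Σω p (λ x → A x ⊗ inv B (oneMinus x))

  ReBinom : (Fin p → ℤω) → (Fin p → ℤω) → ℚ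
  ReBinom A B = Re (a z ℚ./ p) (b z ℚ./ p)
    where z = pBinom A B

_·χ_ : {p : ℕ} → (Fin p → ℤω) → (Fin p → ℤω) → (Fin p → ℤω)
(A ·χ B) x = A x ⊗ B x

legendre3 : ℤ → ℤ
legendre3 x with x %ℕ 3
... | 0 = + 0
... | 1 = + 1
... | _ = - (+ 1)

signPow : ℤ → ℤ
signPow n with ℤ.∣ n ∣ % 2
... | 0 = + 1
... | _ = - (+ 1)

module Submission where

open import Defs
open import Data.Nat as ℕ using (ℕ; NonZero; _%_; zero; suc; _∸_)
open import Data.Nat.Primality using (Prime; prime⇒irreducible; prime⇒nonZero; prime⇒nonTrivial; euclidsLemma)
open import Data.Fin as Fin using (Fin; toℕ)
open import Data.Integer as ℤ using (ℤ; +_; -_; _+_; _-_; _*_; ∣_∣; -[1+_])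
open import Data.Rational as ℚ using (ℚ; ½; _/_)
open import Relation.Binary.PropositionalEquality hiding ([_]; J)
open import Algebra.Bundles using (CommutativeRing)
open import Algebra.Structures using (IsCommutativeRing)
import Algebra.Properties.CommutativeSemigroup as CommutativeSemigroupProperties
import Algebra.Properties.Ring as RingProperties
import Algebra.Properties.Semiring.Sum as SemiringSum
open import Data.Empty using (⊥-elim)
import Data.Fin.Properties as Fin
open import Data.Fin.Permutation using (permutation)
import Data.Integer.Properties as ℤ
open import Data.Integer.DivMod using (_%ℕ_; _/ℕ_; a≡a%ℕn+[a/ℕn]*n; n%ℕd<d)
open import Data.Integer.Tactic.RingSolver as ℤ-Solver using ()
open import Data.Maybe.Base using (Maybe; just; nothing)
import Data.Nat.Properties as ℕ
open import Data.Nat.Coprimality using (prime⇒coprime; coprime-Bézout)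
open import Data.Nat.DivMod using (_mod_; %-distribˡ-+; %-distribˡ-*; m<n⇒m%n≡m; n%n≡0; m*n%n≡0; m%n≤m; m≡m%n+[m/n]*n; m%n<n)
open import Data.Nat.Divisibility using (_∣_; divides)
open import Data.Nat.GCD using (module Bézout)
import Data.Nat.Tactic.RingSolver as ℕ-Solver
open import Data.Product using (∃-syntax; _,_; _×_; proj₁; proj₂)
import Data.Rational.Properties as ℚ
open import Data.Rational.Solver using (module +-*-Solver)
import Data.Rational.Unnormalised as ℚᵘ
import Data.Rational.Unnormalised.Properties as ℚᵘ
open import Data.Sum as Sum using (_⊎_; inj₁; inj₂)
open import Function using (_∘_; id)
open import Level using (0ℓ)
open import Relation.Nullary using (yes; no)
open import Relation.Nullary.Decidable using (toSum)
import Tactic.RingSolver.Core.AlmostCommutativeRing as ACR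
import Tactic.RingSolver.NonReflective as NonReflective

-- All character values lie in ℤ[ω]. As χ(-1) = 1, p·(χ choose χ) = Σ χ(x) χ̄(1 - x) = J(χ, χ̄), which
-- orthogonality evaluates to -1. The second sum is J = J(φχ, χ̄); since φχ, χ̄ and their product φ are
-- nontrivial, |J|² = p. Moreover J ≡ -1 modulo 2 (as φ(x) = ±1) and modulo π = 1 - ω (as cube roots
-- of unity are ≡ 1 mod π), so J = u + 2wω with u - w ≡ -1 (mod 3) and p = N(J) = (u - w)² + 3w².
-- A prime has only one representation p = x² + 3y² up to signs, and x + y is odd; hence
-- u - w = (-1)^{x+y} (x/3) x, while the left-hand side is Re(-1) + Re J = (u - w) - 1.

-- The Eisenstein integers ℤ[ω]

infix 30 ⊖_
⊖_ : ℤω → ℤω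
⊖ (x + y ω) = (- x) + (- y) ω

⊕-assoc : ∀ z w s → (z ⊕ w) ⊕ s ≡ z ⊕ (w ⊕ s)
⊕-assoc (a + b ω) (c + d ω) (e + f ω) = cong₂ _+_ω (ℤ.+-assoc a c e) (ℤ.+-assoc b d f)

⊕-comm : ∀ z w → z ⊕ w ≡ w ⊕ z
⊕-comm (a + b ω) (c + d ω) = cong₂ _+_ω (ℤ.+-comm a c) (ℤ.+-comm b d)

⊕-identityˡ : ∀ z → 0ω ⊕ z ≡ z
⊕-identityˡ (a + b ω) = cong₂ _+_ω (ℤ.+-identityˡ a) (ℤ.+-identityˡ b)

⊕-identityʳ : ∀ z → z ⊕ 0ω ≡ z
⊕-identityʳ (a + b ω) = cong₂ _+_ω (ℤ.+-identityʳ a) (ℤ.+-identityʳ b)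

⊖-inverseˡ : ∀ z → ⊖ z ⊕ z ≡ 0ω
⊖-inverseˡ (a + b ω) = cong₂ _+_ω (ℤ.+-inverseˡ a) (ℤ.+-inverseˡ b)

⊖-inverseʳ : ∀ z → z ⊕ ⊖ z ≡ 0ω
⊖-inverseʳ (a + b ω) = cong₂ _+_ω (ℤ.+-inverseʳ a) (ℤ.+-inverseʳ b)

⊗-assoc : ∀ z w s → (z ⊗ w) ⊗ s ≡ z ⊗ (w ⊗ s)
⊗-assoc (x + y ω) (u + v ω) (s + t ω) = cong₂ _+_ω (re x y u v s t) (im x y u v s t)
  where
  re : ∀ x y u v s t → (x * u - y * v) * s - (x * v + y * u - y * v) * t
                     ≡ x * (u * s - v * t) - y * (u * t + v * s - v * t)
  re = ℤ-Solver.solve-∀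
  im : ∀ x y u v s t → (x * u - y * v) * t + (x * v + y * u - y * v) * s - (x * v + y * u - y * v) * t
                     ≡ x * (u * t + v * s - v * t) + y * (u * s - v * t) - y * (u * t + v * s - v * t)
  im = ℤ-Solver.solve-∀

⊗-comm : ∀ z w → z ⊗ w ≡ w ⊗ z
⊗-comm (x + y ω) (u + v ω) = cong₂ _+_ω (re x y u v) (im x y u v)
  where
  re : ∀ x y u v → x * u - y * v ≡ u * x - v * y
  re = ℤ-Solver.solve-∀
  im : ∀ x y u v → x * v + y * u - y * v ≡ u * y + v * x - v * y
  im = ℤ-Solver.solve-∀

⊗-identityˡ : ∀ z → 1ω ⊗ z ≡ z
⊗-identityˡ (x + y ω) = cong₂ _+_ω (re x) (im y)
  where
  re : ∀ x → + 1 * x - + 0 * + 0 ≡ x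
  re = ℤ-Solver.solve-∀
  im : ∀ y → + 1 * y + + 0 * + 0 - + 0 * y ≡ y
  im = ℤ-Solver.solve-∀

⊗-identityʳ : ∀ z → z ⊗ 1ω ≡ z
⊗-identityʳ z = trans (⊗-comm z 1ω) (⊗-identityˡ z)

⊗-distribˡ-⊕ : ∀ z w s → z ⊗ (w ⊕ s) ≡ (z ⊗ w) ⊕ (z ⊗ s)
⊗-distribˡ-⊕ (x + y ω) (u + v ω) (s + t ω) = cong₂ _+_ω (re x y u v s t) (im x y u v s t)
  where
  re : ∀ x y u v s t → x * (u + s) - y * (v + t) ≡ (x * u - y * v) + (x * s - y * t)
  re = ℤ-Solver.solve-∀
  im : ∀ x y u v s t → x * (v + t) + y * (u + s) - y * (v + t)
                     ≡ (x * v + y * u - y * v) + (x * t + y * s - y * t)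
  im = ℤ-Solver.solve-∀

⊗-distribʳ-⊕ : ∀ s z w → (z ⊕ w) ⊗ s ≡ (z ⊗ s) ⊕ (w ⊗ s)
⊗-distribʳ-⊕ s z w =
  trans (⊗-comm (z ⊕ w) s) (trans (⊗-distribˡ-⊕ s z w) (cong₂ _⊕_ (⊗-comm s z) (⊗-comm s w)))

ℤω-isCommutativeRing : IsCommutativeRing _≡_ _⊕_ _⊗_ ⊖_ 0ω 1ω
ℤω-isCommutativeRing = record
  { isRing = record
    { +-isAbelianGroup = record
      { isGroup = record
        { isMonoid = record
          { isSemigroup = record
            { isMagma = record { isEquivalence = isEquivalence ; ∙-cong = cong₂ _⊕_ }
            ; assoc = ⊕-assoc }
          ; identity = ⊕-identityˡ , ⊕-identityʳ }
        ; inverse = ⊖-inverseˡ , ⊖-inverseʳ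
        ; ⁻¹-cong = cong ⊖_ }
      ; comm = ⊕-comm }
    ; *-cong = cong₂ _⊗_
    ; *-assoc = ⊗-assoc
    ; *-identity = ⊗-identityˡ , ⊗-identityʳ
    ; distrib = ⊗-distribˡ-⊕ , ⊗-distribʳ-⊕
    }
  ; *-comm = ⊗-comm
  }

ℤω-commutativeRing : CommutativeRing 0ℓ 0ℓ
ℤω-commutativeRing = record { isCommutativeRing = ℤω-isCommutativeRing }

ℤω-ring : ACR.AlmostCommutativeRing 0ℓ 0ℓ
ℤω-ring = ACR.fromCommutativeRing ℤω-commutativeRing isZero
  where
  isZero : (z : ℤω) → Maybe (0ω ≡ z)
  isZero ((+ 0) + (+ 0) ω) = just refl
  isZero _ = nothing

open CommutativeRing ℤω-commutativeRing public
  using () renaming (zeroˡ to ⊗-zeroˡ; zeroʳ to ⊗-zeroʳ)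
open RingProperties (CommutativeRing.ring ℤω-commutativeRing) public
  using ()
  renaming ( +-cancelʳ to ⊕-cancelʳ; x∙y⁻¹≈ε⇒x≈y to x⊖y≡0⇒x≡y; -‿involutive to ⊖-involutive; [y-z]x≈yx-zx to ⊗-distribʳ-⊖
           ; x[y-z]≈xy-xz to ⊗-distribˡ-⊖; x≈z//y to x⊕y≡z⇒x≡z⊖y )
open CommutativeSemigroupProperties (CommutativeRing.*-commutativeSemigroup ℤω-commutativeRing) public
  using () renaming (interchange to ⊗-interchange; x∙yz≈y∙xz to x⊗yz≡y⊗xz)

module ℤω-Solver = NonReflective ℤω-ring
  renaming (_⊕_ to infixl 6 _:+_; _⊗_ to infixl 7 _:×_; ⊝_ to infix 8 :-_; _⊜_ to infix 4 _:=_)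

fromℤ : ℤ → ℤω
fromℤ n = n + + 0 ω

two : ℤω
two = fromℤ (+ 2)

conj-involutive : ∀ z → conj (conj z) ≡ z
conj-involutive (a + b ω) = cong₂ _+_ω (re a b) (ℤ.neg-involutive b)
  where
  re : ∀ a b → (a - b) - - b ≡ a
  re = ℤ-Solver.solve-∀

conj-⊕ : ∀ z w → conj (z ⊕ w) ≡ conj z ⊕ conj w
conj-⊕ (a + b ω) (c + d ω) = cong₂ _+_ω (re a b c d) (ℤ.neg-distrib-+ b d)
  where
  re : ∀ a b c d → (a + c) - (b + d) ≡ (a - b) + (c - d)
  re = ℤ-Solver.solve-∀

conj-⊗ : ∀ z w → conj (z ⊗ w) ≡ conj z ⊗ conj w
conj-⊗ (x + y ω) (u + v ω) = cong₂ _+_ω (re x y u v) (im x y u v)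
  where
  re : ∀ x y u v → (x * u - y * v) - (x * v + y * u - y * v) ≡ (x - y) * (u - v) - (- y) * (- v)
  re = ℤ-Solver.solve-∀
  im : ∀ x y u v → - (x * v + y * u - y * v) ≡ (x - y) * (- v) + (- y) * (u - v) - (- y) * (- v)
  im = ℤ-Solver.solve-∀

conj-^ω : ∀ z n → conj (z ^ω n) ≡ conj z ^ω n
conj-^ω z zero = refl
conj-^ω z (suc n) = trans (conj-⊗ z (z ^ω n)) (cong (conj z ⊗_) (conj-^ω z n))

norm : ℤω → ℤ
norm (a + b ω) = a * a - a * b + b * b

conj⊗self≡norm : ∀ z → conj z ⊗ z ≡ fromℤ (norm z)
conj⊗self≡norm (a + b ω) = cong₂ _+_ω (re a b) (im a b)
  where
  re : ∀ a b → (a - b) * a - (- b) * b ≡ a * a - a * b + b * b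
  re = ℤ-Solver.solve-∀
  im : ∀ a b → (a - b) * b + (- b) * a - (- b) * b ≡ + 0
  im = ℤ-Solver.solve-∀

norm-⊗ : ∀ z w → norm (z ⊗ w) ≡ norm z * norm w
norm-⊗ z w = trans (cong ℤω.a fromℤ-norm-⊗) (ℤ.+-identityʳ (norm z * norm w))
  where
  open ≡-Reasoning
  fromℤ-norm-⊗ : fromℤ (norm (z ⊗ w)) ≡ fromℤ (norm z) ⊗ fromℤ (norm w)
  fromℤ-norm-⊗ = begin
    fromℤ (norm (z ⊗ w))          ≡⟨ conj⊗self≡norm (z ⊗ w) ⟨
    conj (z ⊗ w) ⊗ (z ⊗ w)        ≡⟨ cong (_⊗ (z ⊗ w)) (conj-⊗ z w) ⟩
    (conj z ⊗ conj w) ⊗ (z ⊗ w)   ≡⟨ ⊗-interchange (conj z) (conj w) z w ⟩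
    (conj z ⊗ z) ⊗ (conj w ⊗ w)   ≡⟨ cong₂ _⊗_ (conj⊗self≡norm z) (conj⊗self≡norm w) ⟩
    fromℤ (norm z) ⊗ fromℤ (norm w) ∎

i*i≡∣i∣*∣i∣ : ∀ i → i * i ≡ + (∣ i ∣ ℕ.* ∣ i ∣)
i*i≡∣i∣*∣i∣ (+ n) = sym (ℤ.pos-* n n)
i*i≡∣i∣*∣i∣ -[1+ n ] = refl

4*norm≡ : ∀ a b → + 4 * norm (a + b ω)
        ≡ + (∣ + 2 * a - b ∣ ℕ.* ∣ + 2 * a - b ∣ ℕ.+ 3 ℕ.* (∣ b ∣ ℕ.* ∣ b ∣))
4*norm≡ a b = trans (identity a b)
  (cong₂ _+_ (i*i≡∣i∣*∣i∣ (+ 2 * a - b)) (trans (cong (+ 3 *_) (i*i≡∣i∣*∣i∣ b)) (sym (ℤ.pos-* 3 (∣ b ∣ ℕ.* ∣ b ∣)))))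
  where
  identity : ∀ a b → + 4 * (a * a - a * b + b * b) ≡ (+ 2 * a - b) * (+ 2 * a - b) + + 3 * (b * b)
  identity = ℤ-Solver.solve-∀

norm≢-1 : ∀ z → norm z ≢ -[1+ 0 ]
norm≢-1 (a + b ω) eq with trans (sym (4*norm≡ a b)) (cong (+ 4 *_) eq)
... | ()

norm≡0⇒≡0ω : ∀ z → norm z ≡ + 0 → z ≡ 0ω
norm≡0⇒≡0ω (a + b ω) eq = cong₂ _+_ω a≡0 b≡0
  where
  m k : ℕ.ℕ
  m = ∣ + 2 * a - b ∣
  k = ∣ b ∣
  m²+3k²≡0 : m ℕ.* m ℕ.+ 3 ℕ.* (k ℕ.* k) ≡ 0
  m²+3k²≡0 = ℤ.+-injective (trans (sym (4*norm≡ a b)) (cong (+ 4 *_) eq))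
  square≡0 : ∀ n → n ℕ.* n ≡ 0 → n ≡ 0
  square≡0 n n²≡0 = Sum.[ id , id ]′ (ℕ.m*n≡0⇒m≡0∨n≡0 n n²≡0)
  b≡0 : b ≡ + 0
  b≡0 = ℤ.∣i∣≡0⇒i≡0 (square≡0 k (ℕ.m*n≡0⇒m≡0 _ 3 (trans (ℕ.*-comm (k ℕ.* k) 3) (ℕ.m+n≡0⇒n≡0 (m ℕ.* m) m²+3k²≡0))))
  2a≡0 : + 2 * a ≡ + 0
  2a≡0 = trans (sym (ℤ.+-identityʳ _)) (trans (cong (λ t → + 2 * a - t) (sym b≡0))
           (ℤ.∣i∣≡0⇒i≡0 (square≡0 m (ℕ.m+n≡0⇒m≡0 _ m²+3k²≡0))))
  a≡0 : a ≡ + 0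
  a≡0 = ℤ.*-cancelˡ-≡ (+ 2) a (+ 0) 2a≡0

z⊗w≡0⇒z≡0∨w≡0 : ∀ z w → z ⊗ w ≡ 0ω → z ≡ 0ω ⊎ w ≡ 0ω
z⊗w≡0⇒z≡0∨w≡0 z w eq = Sum.map (norm≡0⇒≡0ω z) (norm≡0⇒≡0ω w)
  (ℤ.i*j≡0⇒i≡0∨j≡0 (norm z) (trans (sym (norm-⊗ z w)) (cong norm eq)))

⊗-cancelˡ : ∀ c a b → c ≢ 0ω → c ⊗ a ≡ c ⊗ b → a ≡ b
⊗-cancelˡ c a b c≢0 eq = x⊖y≡0⇒x≡y a b
  (Sum.[ (λ c≡0 → ⊥-elim (c≢0 c≡0)) , id ]′ (z⊗w≡0⇒z≡0∨w≡0 c (a ⊕ ⊖ b) c⊗[a⊖b]≡0))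
  where
  c⊗[a⊖b]≡0 : c ⊗ (a ⊕ ⊖ b) ≡ 0ω
  c⊗[a⊖b]≡0 = trans (⊗-distribˡ-⊖ c a b) (trans (cong (λ t → t ⊕ ⊖ (c ⊗ b)) eq) (⊖-inverseʳ (c ⊗ b)))

unit⇒conj⊗self≡1 : ∀ z w → z ⊗ w ≡ 1ω → conj z ⊗ z ≡ 1ω
unit⇒conj⊗self≡1 z w eq = trans (conj⊗self≡norm z) (cong fromℤ (norm≡1 (norm z) ∣Nz∣≡1 (norm≢-1 z)))
  where
  ∣Nz∣≡1 : ∣ norm z ∣ ≡ 1
  ∣Nz∣≡1 = ℕ.m*n≡1⇒m≡1 _ _ (trans (sym (ℤ.abs-* (norm z) (norm w)))
             (cong ∣_∣ (trans (sym (norm-⊗ z w)) (cong norm eq))))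
  norm≡1 : ∀ n → ∣ n ∣ ≡ 1 → n ≢ -[1+ 0 ] → n ≡ + 1
  norm≡1 (+ _) e _ = cong +_ e
  norm≡1 -[1+ 0 ] _ n≢-1 = ⊥-elim (n≢-1 refl)

z²≡1⇒z≡±1 : ∀ z → z ^ω 2 ≡ 1ω → z ≡ 1ω ⊎ z ≡ ⊖ 1ω
z²≡1⇒z≡±1 z eq = Sum.map (x⊖y≡0⇒x≡y z 1ω) (λ z⊕1≡0 → x⊖y≡0⇒x≡y z (⊖ 1ω) (trans (cong (z ⊕_) (⊖-involutive 1ω)) z⊕1≡0))
  (z⊗w≡0⇒z≡0∨w≡0 (z ⊕ ⊖ 1ω) (z ⊕ 1ω) (trans (factor z) (trans (cong (_⊕ ⊖ 1ω) eq) (⊖-inverseʳ 1ω))))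
  where
  factor : ∀ z → (z ⊕ ⊖ 1ω) ⊗ (z ⊕ 1ω) ≡ (z ⊗ (z ⊗ 1ω)) ⊕ ⊖ 1ω
  factor = solve 1 (λ z → (z :+ :- Κ 1ω) :× (z :+ Κ 1ω) := z :× (z :× Κ 1ω) :+ :- Κ 1ω) refl
    where open ℤω-Solver

z³≡1∧z²≡1⇒z≡1 : ∀ {z} → z ^ω 3 ≡ 1ω → z ^ω 2 ≡ 1ω → z ≡ 1ω
z³≡1∧z²≡1⇒z≡1 {z} z³≡1 z²≡1 = trans (sym (⊗-identityʳ z)) (trans (cong (z ⊗_) (sym z²≡1)) z³≡1)

^ω-distrib-⊗ : ∀ z w n → (z ⊗ w) ^ω n ≡ (z ^ω n) ⊗ (w ^ω n)
^ω-distrib-⊗ z w zero = refl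
^ω-distrib-⊗ z w (suc n) =
  trans (cong ((z ⊗ w) ⊗_) (^ω-distrib-⊗ z w n)) (⊗-interchange z w (z ^ω n) (w ^ω n))

ζ : ℤω
ζ = (+ 0) + (+ 1) ω

π : ℤω
π = 1ω ⊕ ⊖ ζ

infix 4 _≡_[mod_]
record _≡_[mod_] (z w m : ℤω) : Set where
  constructor congruent
  field
    quotient : ℤω
    equation : z ≡ w ⊕ (m ⊗ quotient)
open _≡_[mod_] public

z³≡1⇒z≡1[modπ] : ∀ z → z ^ω 3 ≡ 1ω → z ≡ 1ω [mod π ]
z³≡1⇒z≡1[modπ] z eq =
  Sum.[ root 0ω , Sum.[ root (⊖ 1ω) , root (⊖ (1ω ⊕ ζ)) ]′ ∘ z⊗w≡0⇒z≡0∨w≡0 (z ⊕ ⊖ ζ) _ ]′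
    (z⊗w≡0⇒z≡0∨w≡0 (z ⊕ ⊖ 1ω) _ product≡0)
  where
  -- with w = ζ the last summand vanishes, as ζ² + ζ + 1 = 0
  factor : ∀ z w → (z ⊕ ⊖ 1ω) ⊗ ((z ⊕ ⊖ w) ⊗ (z ⊕ (1ω ⊕ w)))
                 ≡ ((z ⊗ (z ⊗ (z ⊗ 1ω))) ⊕ ⊖ 1ω) ⊕ ((1ω ⊕ ⊖ z) ⊗ ((w ⊗ w) ⊕ (w ⊕ 1ω)))
  factor = solve 2 (λ z w → (z :+ :- Κ 1ω) :× ((z :+ :- w) :× (z :+ (Κ 1ω :+ w)))
                         := (z :× (z :× (z :× Κ 1ω)) :+ :- Κ 1ω) :+ (Κ 1ω :+ :- z) :× (w :× w :+ (w :+ Κ 1ω))) refl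
    where open ℤω-Solver
  product≡0 : (z ⊕ ⊖ 1ω) ⊗ ((z ⊕ ⊖ ζ) ⊗ (z ⊕ (1ω ⊕ ζ))) ≡ 0ω
  product≡0 = trans (factor z ζ) (cong₂ (λ c s → (c ⊕ ⊖ 1ω) ⊕ s) eq (⊗-zeroʳ (1ω ⊕ ⊖ z)))
  root : ∀ h → z ⊕ ⊖ (1ω ⊕ (π ⊗ h)) ≡ 0ω → z ≡ 1ω [mod π ]
  root h z≡1+πh = congruent h (x⊖y≡0⇒x≡y z _ z≡1+πh)

≡⇒≡[mod] : ∀ {z w} m → z ≡ w → z ≡ w [mod m ]
≡⇒≡[mod] {z} m refl = congruent 0ω (sym (trans (cong (z ⊕_) (⊗-zeroʳ m)) (⊕-identityʳ z)))

[mod]-⊗ : ∀ {a a′ b b′ m} → a ≡ a′ [mod m ] → b ≡ b′ [mod m ] → a ⊗ b ≡ a′ ⊗ b′ [mod m ]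
[mod]-⊗ {a′ = a′} {b′ = b′} {m} (congruent h refl) (congruent k refl) =
  congruent ((h ⊗ b′) ⊕ ((a′ ⊗ k) ⊕ (m ⊗ (h ⊗ k)))) (expand a′ b′ m h k)
  where
  expand : ∀ a b m h k → (a ⊕ (m ⊗ h)) ⊗ (b ⊕ (m ⊗ k))
                       ≡ (a ⊗ b) ⊕ (m ⊗ ((h ⊗ b) ⊕ ((a ⊗ k) ⊕ (m ⊗ (h ⊗ k)))))
  expand = solve 5 (λ a b m h k → (a :+ m :× h) :× (b :+ m :× k)
                                := a :× b :+ m :× (h :× b :+ (a :× k :+ m :× (h :× k)))) refl
    where open ℤω-Solver

±1≡1[mod2] : ∀ {z} → z ≡ 1ω ⊎ z ≡ ⊖ 1ω → z ≡ 1ω [mod two ]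
±1≡1[mod2] (inj₁ refl) = ≡⇒≡[mod] two refl
±1≡1[mod2] (inj₂ refl) = congruent (⊖ 1ω) refl

π⊗ : ∀ c d → π ⊗ (c + d ω) ≡ (c + d) + (+ 2 * d - c) ω
π⊗ c d = cong₂ _+_ω (re c d) (im c d)
  where
  re : ∀ c d → + 1 * c - -[1+ 0 ] * d ≡ c + d
  re = ℤ-Solver.solve-∀
  im : ∀ c d → + 1 * d + -[1+ 0 ] * c - -[1+ 0 ] * d ≡ + 2 * d - c
  im = ℤ-Solver.solve-∀

two⊗ : ∀ c d → two ⊗ (c + d ω) ≡ (+ 2 * c) + (+ 2 * d) ω
two⊗ c d = cong₂ _+_ω (re c d) (im c d)
  where
  re : ∀ c d → + 2 * c - + 0 * d ≡ + 2 * c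
  re = ℤ-Solver.solve-∀
  im : ∀ c d → + 2 * d + + 0 * c - + 0 * d ≡ + 2 * d
  im = ℤ-Solver.solve-∀

primary-coordinates : ∀ {S} → S ≡ ⊖ 1ω [mod two ] → S ≡ ⊖ 1ω [mod π ] →
                      ∃[ w ] ∃[ t ] ℤω.b S ≡ + 2 * w × ℤω.a S - w ≡ -[1+ 0 ] + + 3 * t
primary-coordinates {S} (congruent (c + d ω) S≡-1+2W) (congruent (e + f ω) S≡-1+πV) = d , f - d , bS≡2d , aS-d≡-1+3t
  where
  S≡-1+2c+2dω : S ≡ ⊖ 1ω ⊕ ((+ 2 * c) + (+ 2 * d) ω)
  S≡-1+2c+2dω = trans S≡-1+2W (cong (⊖ 1ω ⊕_) (two⊗ c d))
  S≡-1+πV′ : S ≡ ⊖ 1ω ⊕ ((e + f) + (+ 2 * f - e) ω)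
  S≡-1+πV′ = trans S≡-1+πV (cong (⊖ 1ω ⊕_) (π⊗ e f))
  bS≡2d : ℤω.b S ≡ + 2 * d
  bS≡2d = trans (cong ℤω.b S≡-1+2c+2dω) (ℤ.+-identityˡ (+ 2 * d))
  2d≡2f-e : + 2 * d ≡ + 2 * f - e
  2d≡2f-e = trans (sym bS≡2d) (trans (cong ℤω.b S≡-1+πV′) (ℤ.+-identityˡ (+ 2 * f - e)))
  aS-d≡-1+3t : ℤω.a S - d ≡ -[1+ 0 ] + + 3 * (f - d)
  aS-d≡-1+3t = begin
    ℤω.a S - d                                               ≡⟨ cong (_- d) (cong ℤω.a S≡-1+πV′) ⟩
    -[1+ 0 ] + (e + f) - d                                   ≡⟨ identity e f d ⟩
    -[1+ 0 ] + + 3 * (f - d) - ((+ 2 * f - e) - + 2 * d)     ≡⟨ cong (λ t → -[1+ 0 ] + + 3 * (f - d) - t) (ℤ.i≡j⇒i-j≡0 (sym 2d≡2f-e)) ⟩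
    -[1+ 0 ] + + 3 * (f - d) - + 0                           ≡⟨ ℤ.+-identityʳ _ ⟩
    -[1+ 0 ] + + 3 * (f - d)                                 ∎
    where
    open ≡-Reasoning
    identity : ∀ e f d → -[1+ 0 ] + (e + f) - d ≡ -[1+ 0 ] + + 3 * (f - d) - ((+ 2 * f - e) - + 2 * d)
    identity = ℤ-Solver.solve-∀

norm-primary : ∀ u w → norm (u + (+ 2 * w) ω) ≡ (u - w) * (u - w) + + 3 * (w * w)
norm-primary = identity
  where
  identity : ∀ u w → u * u - u * (+ 2 * w) + (+ 2 * w) * (+ 2 * w) ≡ (u - w) * (u - w) + + 3 * (w * w)
  identity = ℤ-Solver.solve-∀

-- Sums over Fin n

private
  module Σ = SemiringSum (CommutativeRing.semiring ℤω-commutativeRing)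

Σω≡sum : ∀ n f → Σω n f ≡ Σ.sum f
Σω≡sum zero f = refl
Σω≡sum (suc n) f = cong (f Fin.zero ⊕_) (Σω≡sum n (f ∘ Fin.suc))

Σω-cong : ∀ n {f g : Fin n → ℤω} → (∀ x → f x ≡ g x) → Σω n f ≡ Σω n g
Σω-cong zero f≗g = refl
Σω-cong (suc n) f≗g = cong₂ _⊕_ (f≗g Fin.zero) (Σω-cong n (f≗g ∘ Fin.suc))

Σω-distrib-⊕ : ∀ n (f g : Fin n → ℤω) → Σω n (λ x → f x ⊕ g x) ≡ Σω n f ⊕ Σω n g
Σω-distrib-⊕ n f g = begin
  Σω n (λ x → f x ⊕ g x)    ≡⟨ Σω≡sum n _ ⟩
  Σ.sum (λ x → f x ⊕ g x)   ≡⟨ Σ.∑-distrib-+ f g ⟩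
  Σ.sum f ⊕ Σ.sum g         ≡⟨ cong₂ _⊕_ (Σω≡sum n f) (Σω≡sum n g) ⟨
  Σω n f ⊕ Σω n g           ∎
  where open ≡-Reasoning

Σω-distribˡ-⊗ : ∀ n c (f : Fin n → ℤω) → Σω n (λ x → c ⊗ f x) ≡ c ⊗ Σω n f
Σω-distribˡ-⊗ n c f = begin
  Σω n (λ x → c ⊗ f x)   ≡⟨ Σω≡sum n _ ⟩
  Σ.sum (λ x → c ⊗ f x)  ≡⟨ Σ.*-distribˡ-sum c f ⟨
  c ⊗ Σ.sum f            ≡⟨ cong (c ⊗_) (Σω≡sum n f) ⟨
  c ⊗ Σω n f             ∎
  where open ≡-Reasoning

Σω-distribʳ-⊗ : ∀ n c (f : Fin n → ℤω) → Σω n (λ x → f x ⊗ c) ≡ Σω n f ⊗ c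
Σω-distribʳ-⊗ n c f =
  trans (Σω-cong n (λ x → ⊗-comm (f x) c)) (trans (Σω-distribˡ-⊗ n c f) (⊗-comm c (Σω n f)))

Σω-zero : ∀ n (f : Fin n → ℤω) → (∀ x → f x ≡ 0ω) → Σω n f ≡ 0ω
Σω-zero zero f f≗0 = refl
Σω-zero (suc n) f f≗0 = trans (cong₂ _⊕_ (f≗0 Fin.zero) (Σω-zero n (f ∘ Fin.suc) (f≗0 ∘ Fin.suc))) (⊕-identityˡ 0ω)

Σω-single : ∀ n (f : Fin n → ℤω) i → (∀ x → x ≢ i → f x ≡ 0ω) → Σω n f ≡ f i
Σω-single (suc n) f i f≗0 = begin
  Σω (suc n) f                     ≡⟨ Σω≡sum (suc n) f ⟩
  Σ.sum f                          ≡⟨ Σ.sum-remove f ⟩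
  f i ⊕ Σ.sum (f ∘ Fin.punchIn i)  ≡⟨ cong (f i ⊕_) (Σω≡sum n (f ∘ Fin.punchIn i)) ⟨
  f i ⊕ Σω n (f ∘ Fin.punchIn i)   ≡⟨ cong (f i ⊕_) (Σω-zero n _ (λ j → f≗0 _ (Fin.punchInᵢ≢i i j))) ⟩
  f i ⊕ 0ω                         ≡⟨ ⊕-identityʳ (f i) ⟩
  f i                              ∎
  where open ≡-Reasoning

Σω-comm : ∀ m n (f : Fin m → Fin n → ℤω) → Σω m (λ x → Σω n (f x)) ≡ Σω n (λ y → Σω m (λ x → f x y))
Σω-comm m n f = begin
  Σω m (λ x → Σω n (f x))             ≡⟨ Σω-cong m (λ x → Σω≡sum n (f x)) ⟩
  Σω m (λ x → Σ.sum (f x))            ≡⟨ Σω≡sum m _ ⟩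
  Σ.sum (λ x → Σ.sum (f x))           ≡⟨ Σ.∑-comm f ⟩
  Σ.sum (λ y → Σ.sum (λ x → f x y))   ≡⟨ Σω≡sum n _ ⟨
  Σω n (λ y → Σ.sum (λ x → f x y))    ≡⟨ Σω-cong n (λ y → Σω≡sum m (λ x → f x y)) ⟨
  Σω n (λ y → Σω m (λ x → f x y))     ∎
  where open ≡-Reasoning

Σω-permute : ∀ n (f : Fin n → ℤω) (π π⁻¹ : Fin n → Fin n) →
             (∀ x → π (π⁻¹ x) ≡ x) → (∀ x → π⁻¹ (π x) ≡ x) → Σω n f ≡ Σω n (f ∘ π)
Σω-permute n f π π⁻¹ ππ⁻¹≗id π⁻¹π≗id = begin
  Σω n f        ≡⟨ Σω≡sum n f ⟩
  Σ.sum f       ≡⟨ Σ.sum-permute f (permutation π π⁻¹ ππ⁻¹≗id π⁻¹π≗id) ⟩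
  Σ.sum (f ∘ π) ≡⟨ Σω≡sum n (f ∘ π) ⟨
  Σω n (f ∘ π)  ∎
  where open ≡-Reasoning

Σω-conj : ∀ n (f : Fin n → ℤω) → Σω n (conj ∘ f) ≡ conj (Σω n f)
Σω-conj zero f = refl
Σω-conj (suc n) f =
  trans (cong (conj (f Fin.zero) ⊕_) (Σω-conj n (f ∘ Fin.suc))) (sym (conj-⊕ (f Fin.zero) (Σω n (f ∘ Fin.suc))))

Σω-const-1 : ∀ n → Σω n (λ _ → 1ω) ≡ fromℤ (+ n)
Σω-const-1 zero = refl
Σω-const-1 (suc n) = cong (1ω ⊕_) (Σω-const-1 n)

Σω-cong-mod : ∀ n {f g : Fin n → ℤω} m → (∀ x → f x ≡ g x [mod m ]) → Σω n f ≡ Σω n g [mod m ]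
Σω-cong-mod n {f} {g} m f≡g = congruent (Σω n (quotient ∘ f≡g)) (begin
  Σω n f                                        ≡⟨ Σω-cong n (equation ∘ f≡g) ⟩
  Σω n (λ x → g x ⊕ (m ⊗ quotient (f≡g x)))    ≡⟨ Σω-distrib-⊕ n g _ ⟩
  Σω n g ⊕ Σω n (λ x → m ⊗ quotient (f≡g x))   ≡⟨ cong (Σω n g ⊕_) (Σω-distribˡ-⊗ n m _) ⟩
  Σω n g ⊕ (m ⊗ Σω n (quotient ∘ f≡g))         ∎)
  where open ≡-Reasoning

-- The ring ℤ/pℤ and the field 𝔽_p

module ℤMod (p : ℕ) .{{_ : NonZero p}} where

  [_] : ℕ → Fin p
  [ m ] = m mod p

  toℕ-[] : ∀ m → toℕ [ m ] ≡ m % p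
  toℕ-[] m = Fin.toℕ-fromℕ< _

  []-toℕ : ∀ x → [ toℕ x ] ≡ x
  []-toℕ x = Fin.toℕ-injective (trans (toℕ-[] (toℕ x)) (m<n⇒m%n≡m (Fin.toℕ<n x)))

  []-cong-% : ∀ {m n} → m % p ≡ n % p → [ m ] ≡ [ n ]
  []-cong-% {m} {n} eq = Fin.toℕ-injective (trans (toℕ-[] m) (trans eq (sym (toℕ-[] n))))

  0%p≡0 : 0 % p ≡ 0
  0%p≡0 = ℕ.n≤0⇒n≡0 (m%n≤m 0 p)

  infixl 6 _+F_
  infixl 7 _*F_
  infix 8 -F_

  0F 1F : Fin p
  0F = zeroF p
  1F = oneF p

  opaque
    _+F_ : Fin p → Fin p → Fin p
    x +F y = [ toℕ x ℕ.+ toℕ y ]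

    _*F_ : Fin p → Fin p → Fin p
    _*F_ = _·F_ p

    -F_ : Fin p → Fin p
    -F x = [ p ∸ toℕ x ]

  opaque
    unfolding _+F_ _*F_ -F_

    ·F≡*F : ∀ x y → _·F_ p x y ≡ x *F y
    ·F≡*F x y = refl

    []+[] : ∀ m n → [ m ] +F [ n ] ≡ [ m ℕ.+ n ]
    []+[] m n = []-cong-% (trans (cong₂ (λ a b → (a ℕ.+ b) % p) (toℕ-[] m) (toℕ-[] n)) (sym (%-distribˡ-+ m n p)))

    []*[] : ∀ m n → [ m ] *F [ n ] ≡ [ m ℕ.* n ]
    []*[] m n = []-cong-% (trans (cong₂ (λ a b → (a ℕ.* b) % p) (toℕ-[] m) (toℕ-[] n)) (sym (%-distribˡ-* m n p)))

    +F-comm : ∀ x y → x +F y ≡ y +F x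
    +F-comm x y = cong [_] (ℕ.+-comm (toℕ x) (toℕ y))

    *F-comm : ∀ x y → x *F y ≡ y *F x
    *F-comm x y = cong [_] (ℕ.*-comm (toℕ x) (toℕ y))

    -F‿inverseˡ : ∀ x → -F x +F x ≡ 0F
    -F‿inverseˡ x = begin
      -F x +F x                       ≡⟨ cong (-F x +F_) ([]-toℕ x) ⟨
      [ p ∸ toℕ x ] +F [ toℕ x ]      ≡⟨ []+[] (p ∸ toℕ x) (toℕ x) ⟩
      [ p ∸ toℕ x ℕ.+ toℕ x ]         ≡⟨ cong [_] (ℕ.m∸n+n≡m (Fin.toℕ≤n x)) ⟩
      [ p ]                           ≡⟨ []-cong-% (trans (n%n≡0 p) (sym 0%p≡0)) ⟩
      0F                              ∎
      where open ≡-Reasoning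

    +F-assoc : ∀ x y z → (x +F y) +F z ≡ x +F (y +F z)
    +F-assoc x y z = begin
      (x +F y) +F z                          ≡⟨ cong ((x +F y) +F_) ([]-toℕ z) ⟨
      [ toℕ x ℕ.+ toℕ y ] +F [ toℕ z ]       ≡⟨ []+[] (toℕ x ℕ.+ toℕ y) (toℕ z) ⟩
      [ toℕ x ℕ.+ toℕ y ℕ.+ toℕ z ]          ≡⟨ cong [_] (ℕ.+-assoc (toℕ x) (toℕ y) (toℕ z)) ⟩
      [ toℕ x ℕ.+ (toℕ y ℕ.+ toℕ z) ]        ≡⟨ []+[] (toℕ x) (toℕ y ℕ.+ toℕ z) ⟨
      [ toℕ x ] +F [ toℕ y ℕ.+ toℕ z ]       ≡⟨ cong (_+F (y +F z)) ([]-toℕ x) ⟩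
      x +F (y +F z)                          ∎
      where open ≡-Reasoning

    *F-assoc : ∀ x y z → (x *F y) *F z ≡ x *F (y *F z)
    *F-assoc x y z = begin
      (x *F y) *F z                          ≡⟨ cong ((x *F y) *F_) ([]-toℕ z) ⟨
      [ toℕ x ℕ.* toℕ y ] *F [ toℕ z ]       ≡⟨ []*[] (toℕ x ℕ.* toℕ y) (toℕ z) ⟩
      [ toℕ x ℕ.* toℕ y ℕ.* toℕ z ]          ≡⟨ cong [_] (ℕ.*-assoc (toℕ x) (toℕ y) (toℕ z)) ⟩
      [ toℕ x ℕ.* (toℕ y ℕ.* toℕ z) ]        ≡⟨ []*[] (toℕ x) (toℕ y ℕ.* toℕ z) ⟨
      [ toℕ x ] *F [ toℕ y ℕ.* toℕ z ]       ≡⟨ cong (_*F (y *F z)) ([]-toℕ x) ⟩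
      x *F (y *F z)                          ∎
      where open ≡-Reasoning

    *F-distribˡ-+F : ∀ x y z → x *F (y +F z) ≡ (x *F y) +F (x *F z)
    *F-distribˡ-+F x y z = begin
      x *F (y +F z)                                ≡⟨ cong (_*F (y +F z)) ([]-toℕ x) ⟨
      [ toℕ x ] *F [ toℕ y ℕ.+ toℕ z ]             ≡⟨ []*[] (toℕ x) (toℕ y ℕ.+ toℕ z) ⟩
      [ toℕ x ℕ.* (toℕ y ℕ.+ toℕ z) ]              ≡⟨ cong [_] (ℕ.*-distribˡ-+ (toℕ x) (toℕ y) (toℕ z)) ⟩
      [ toℕ x ℕ.* toℕ y ℕ.+ toℕ x ℕ.* toℕ z ]      ≡⟨ []+[] (toℕ x ℕ.* toℕ y) (toℕ x ℕ.* toℕ z) ⟨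
      (x *F y) +F (x *F z)                         ∎
      where open ≡-Reasoning

    +F-identityˡ : ∀ x → 0F +F x ≡ x
    +F-identityˡ x = trans (cong (λ t → [ t ℕ.+ toℕ x ]) (trans (toℕ-[] 0) 0%p≡0)) ([]-toℕ x)

    *F-identityˡ : ∀ x → 1F *F x ≡ x
    *F-identityˡ x = begin
      1F *F x              ≡⟨ cong (1F *F_) ([]-toℕ x) ⟨
      [ 1 ] *F [ toℕ x ]   ≡⟨ []*[] 1 (toℕ x) ⟩
      [ 1 ℕ.* toℕ x ]      ≡⟨ cong [_] (ℕ.*-identityˡ (toℕ x)) ⟩
      [ toℕ x ]            ≡⟨ []-toℕ x ⟩
      x                    ∎
      where open ≡-Reasoning

    oneMinus≡1-x : ∀ x → oneMinus p x ≡ 1F +F -F x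
    oneMinus≡1-x x = sym (begin
      [ 1 ] +F [ p ∸ toℕ x ]   ≡⟨ []+[] 1 (p ∸ toℕ x) ⟩
      [ 1 ℕ.+ (p ∸ toℕ x) ]    ≡⟨ cong [_] (ℕ.+-∸-assoc 1 (Fin.toℕ≤n x)) ⟨
      [ 1 ℕ.+ p ∸ toℕ x ]      ∎)
      where open ≡-Reasoning

    minusOne≡-1 : toℕ 1F ≡ 1 → minusOneF p ≡ -F 1F
    minusOne≡-1 toℕ1≡1 = cong (λ t → [ p ∸ t ]) (sym toℕ1≡1)

  +F-identityʳ : ∀ x → x +F 0F ≡ x
  +F-identityʳ x = trans (+F-comm x 0F) (+F-identityˡ x)

  -F‿inverseʳ : ∀ x → x +F -F x ≡ 0F
  -F‿inverseʳ x = trans (+F-comm x (-F x)) (-F‿inverseˡ x)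

  *F-identityʳ : ∀ x → x *F 1F ≡ x
  *F-identityʳ x = trans (*F-comm x 1F) (*F-identityˡ x)

  *F-distribʳ-+F : ∀ x y z → (y +F z) *F x ≡ (y *F x) +F (z *F x)
  *F-distribʳ-+F x y z =
    trans (*F-comm (y +F z) x) (trans (*F-distribˡ-+F x y z) (cong₂ _+F_ (*F-comm x y) (*F-comm x z)))

  ℤMod-isCommutativeRing : IsCommutativeRing _≡_ _+F_ _*F_ -F_ 0F 1F
  ℤMod-isCommutativeRing = record
    { isRing = record
      { +-isAbelianGroup = record
        { isGroup = record
          { isMonoid = record
            { isSemigroup = record
              { isMagma = record { isEquivalence = isEquivalence ; ∙-cong = cong₂ _+F_ }
              ; assoc = +F-assoc }
            ; identity = +F-identityˡ , +F-identityʳ }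
          ; inverse = -F‿inverseˡ , -F‿inverseʳ
          ; ⁻¹-cong = cong -F_ }
        ; comm = +F-comm }
      ; *-cong = cong₂ _*F_
      ; *-assoc = *F-assoc
      ; *-identity = *F-identityˡ , *F-identityʳ
      ; distrib = *F-distribˡ-+F , *F-distribʳ-+F
      }
    ; *-comm = *F-comm
    }

  ℤMod-commutativeRing : CommutativeRing 0ℓ 0ℓ
  ℤMod-commutativeRing = record { isCommutativeRing = ℤMod-isCommutativeRing }

  open CommutativeRing ℤMod-commutativeRing public
    using () renaming (zeroˡ to *F-zeroˡ; zeroʳ to *F-zeroʳ)
  open CommutativeSemigroupProperties (CommutativeRing.*-commutativeSemigroup ℤMod-commutativeRing) public
    using () renaming (interchange to *F-interchange; x∙yz≈y∙xz to x*yz≡y*xz)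
  open RingProperties (CommutativeRing.ring ℤMod-commutativeRing) public
    using ()
    renaming ( -‿involutive to -F‿involutive; +-inverseʳ-unique to -F‿unique; x∙y⁻¹≈ε⇒x≈y to x-y≡0⇒x≡y
             ; -1*x≈-x to -1*x≡-x; -‿distribʳ-* to -F‿distribʳ-*F; -0#≈0# to -0F≡0F
             ; ⁻¹-anti-homo‿- to -F‿anti-homo‿- )

  -1*-1≡1 : -F 1F *F -F 1F ≡ 1F
  -1*-1≡1 = trans (-1*x≡-x (-F 1F)) (-F‿involutive 1F)

  1-x≡-1*[x-1] : ∀ x → 1F +F -F x ≡ -F 1F *F (x +F -F 1F)
  1-x≡-1*[x-1] x = sym (trans (-1*x≡-x (x +F -F 1F)) (-F‿anti-homo‿- x 1F))

  [m*p]≡0F : ∀ m → [ m ℕ.* p ] ≡ 0F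
  [m*p]≡0F m = []-cong-% (trans (m*n%n≡0 m p) (sym 0%p≡0))

  x*[m]≡[m*x] : ∀ x m → x *F [ m ] ≡ [ m ℕ.* toℕ x ]
  x*[m]≡[m*x] x m = trans (cong (_*F [ m ]) (sym ([]-toℕ x)))
                          (trans ([]*[] (toℕ x) m) (cong [_] (ℕ.*-comm (toℕ x) m)))

  module Field (prime : Prime p) where

    1<p : 1 ℕ.< p
    1<p = ℕ.nonTrivial⇒n>1 p {{prime⇒nonTrivial prime}}

    toℕ-1F : toℕ 1F ≡ 1
    toℕ-1F = trans (toℕ-[] 1) (m<n⇒m%n≡m 1<p)

    1F≢0F : 1F ≢ 0F
    1F≢0F 1≡0 = ℕ.1+n≢0 (trans (sym toℕ-1F) (trans (cong toℕ 1≡0) (trans (toℕ-[] 0) 0%p≡0)))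

    -1≢0 : -F 1F ≢ 0F
    -1≢0 -1≡0 = 1F≢0F (trans (sym (-F‿involutive 1F)) (trans (cong -F_ -1≡0) -0F≡0F))

    minusOneF≡-1F : minusOneF p ≡ -F 1F
    minusOneF≡-1F = minusOne≡-1 toℕ-1F

    inverse-exists : ∀ x → x ≢ 0F → ∃[ y ] x *F y ≡ 1F
    inverse-exists x x≢0 = fromBézout (coprime-Bézout (prime⇒coprime prime {{nonZero}} (Fin.toℕ<n x)))
      where
      nonZero : NonZero (toℕ x)
      nonZero = ℕ.≢-nonZero (λ x≡0 → x≢0 (Fin.toℕ-injective (trans x≡0 (sym (trans (toℕ-[] 0) 0%p≡0)))))
      fromBézout : Bézout.Identity 1 p (toℕ x) → ∃[ y ] x *F y ≡ 1F
      fromBézout (Bézout.-+ a b 1+ap≡bx) = [ b ] , (begin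
        x *F [ b ]               ≡⟨ x*[m]≡[m*x] x b ⟩
        [ b ℕ.* toℕ x ]          ≡⟨ cong [_] 1+ap≡bx ⟨
        [ 1 ℕ.+ a ℕ.* p ]        ≡⟨ []+[] 1 (a ℕ.* p) ⟨
        1F +F [ a ℕ.* p ]        ≡⟨ cong (1F +F_) ([m*p]≡0F a) ⟩
        1F +F 0F                 ≡⟨ +F-identityʳ 1F ⟩
        1F                       ∎)
        where open ≡-Reasoning
      fromBézout (Bézout.+- a b 1+bx≡ap) = -F [ b ] , (begin
        x *F -F [ b ]            ≡⟨ -F‿distribʳ-*F x [ b ] ⟨
        -F (x *F [ b ])          ≡⟨ cong -F_ (trans (x*[m]≡[m*x] x b) [bx]≡-1) ⟩
        -F -F 1F                 ≡⟨ -F‿involutive 1F ⟩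
        1F                       ∎)
        where
        open ≡-Reasoning
        [bx]≡-1 : [ b ℕ.* toℕ x ] ≡ -F 1F
        [bx]≡-1 = -F‿unique 1F _ (begin
          1F +F [ b ℕ.* toℕ x ]    ≡⟨ []+[] 1 (b ℕ.* toℕ x) ⟩
          [ 1 ℕ.+ b ℕ.* toℕ x ]    ≡⟨ cong [_] 1+bx≡ap ⟩
          [ a ℕ.* p ]              ≡⟨ [m*p]≡0F a ⟩
          0F                       ∎)

    -- 0F ⁻¹ = 0F is a junk value; it makes _⁻¹ an involution of all of Fin p
    infix 9 _⁻¹
    _⁻¹ : Fin p → Fin p
    x ⁻¹ with x Fin.≟ 0F
    ... | yes _ = 0F
    ... | no x≢0 = proj₁ (inverse-exists x x≢0)

    0F⁻¹≡0F : 0F ⁻¹ ≡ 0F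
    0F⁻¹≡0F with 0F Fin.≟ 0F
    ... | yes _ = refl
    ... | no 0≢0 = ⊥-elim (0≢0 refl)

    *F-inverseʳ : ∀ x → x ≢ 0F → x *F x ⁻¹ ≡ 1F
    *F-inverseʳ x x≢0 with x Fin.≟ 0F
    ... | yes x≡0 = ⊥-elim (x≢0 x≡0)
    ... | no x≢0 = proj₂ (inverse-exists x x≢0)

    *F-inverseˡ : ∀ x → x ≢ 0F → x ⁻¹ *F x ≡ 1F
    *F-inverseˡ x x≢0 = trans (*F-comm (x ⁻¹) x) (*F-inverseʳ x x≢0)

    ⁻¹-unique : ∀ x y → x *F y ≡ 1F → y ≡ x ⁻¹
    ⁻¹-unique x y xy≡1 = begin
      y                     ≡⟨ *F-identityˡ y ⟨
      1F *F y               ≡⟨ cong (_*F y) (*F-inverseˡ x x≢0) ⟨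
      (x ⁻¹ *F x) *F y      ≡⟨ *F-assoc (x ⁻¹) x y ⟩
      x ⁻¹ *F (x *F y)      ≡⟨ cong (x ⁻¹ *F_) xy≡1 ⟩
      x ⁻¹ *F 1F            ≡⟨ *F-identityʳ (x ⁻¹) ⟩
      x ⁻¹                  ∎
      where
      open ≡-Reasoning
      x≢0 : x ≢ 0F
      x≢0 x≡0 = 1F≢0F (trans (sym xy≡1) (trans (cong (_*F y) x≡0) (*F-zeroˡ y)))

    x+d≡x[1+dx⁻¹] : ∀ x d → x ≢ 0F → x +F d ≡ x *F (1F +F d *F x ⁻¹)
    x+d≡x[1+dx⁻¹] x d x≢0 = sym (begin
      x *F (1F +F d *F x ⁻¹)           ≡⟨ *F-distribˡ-+F x 1F (d *F x ⁻¹) ⟩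
      x *F 1F +F x *F (d *F x ⁻¹)      ≡⟨ cong₂ _+F_ (*F-identityʳ x) (x*yz≡y*xz x d (x ⁻¹)) ⟩
      x +F d *F (x *F x ⁻¹)            ≡⟨ cong (λ t → x +F d *F t) (*F-inverseʳ x x≢0) ⟩
      x +F d *F 1F                     ≡⟨ cong (x +F_) (*F-identityʳ d) ⟩
      x +F d                           ∎)
      where open ≡-Reasoning

    ≡0F⊎≢0F : ∀ x → x ≡ 0F ⊎ x ≢ 0F
    ≡0F⊎≢0F x = toSum (x Fin.≟ 0F)

    ⁻¹-involutive : ∀ x → x ⁻¹ ⁻¹ ≡ x
    ⁻¹-involutive x = Sum.[ zero-case , (λ x≢0 → sym (⁻¹-unique (x ⁻¹) x (*F-inverseˡ x x≢0))) ]′ (≡0F⊎≢0F x)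
      where
      zero-case : x ≡ 0F → x ⁻¹ ⁻¹ ≡ x
      zero-case refl = trans (cong _⁻¹ 0F⁻¹≡0F) 0F⁻¹≡0F

    ⁻¹-distrib-*F : ∀ x y → (x *F y) ⁻¹ ≡ x ⁻¹ *F y ⁻¹
    ⁻¹-distrib-*F x y = Sum.[ x≡0 , (λ x≢0 → Sum.[ y≡0 , both≢0 x≢0 ]′ (≡0F⊎≢0F y)) ]′ (≡0F⊎≢0F x)
      where
      open ≡-Reasoning
      x≡0 : x ≡ 0F → (x *F y) ⁻¹ ≡ x ⁻¹ *F y ⁻¹
      x≡0 refl = begin
        (0F *F y) ⁻¹          ≡⟨ cong _⁻¹ (*F-zeroˡ y) ⟩
        0F ⁻¹                 ≡⟨ 0F⁻¹≡0F ⟩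
        0F                    ≡⟨ *F-zeroˡ (y ⁻¹) ⟨
        0F *F y ⁻¹            ≡⟨ cong (_*F y ⁻¹) 0F⁻¹≡0F ⟨
        0F ⁻¹ *F y ⁻¹         ∎
      y≡0 : y ≡ 0F → (x *F y) ⁻¹ ≡ x ⁻¹ *F y ⁻¹
      y≡0 refl = begin
        (x *F 0F) ⁻¹          ≡⟨ cong _⁻¹ (*F-zeroʳ x) ⟩
        0F ⁻¹                 ≡⟨ 0F⁻¹≡0F ⟩
        0F                    ≡⟨ *F-zeroʳ (x ⁻¹) ⟨
        x ⁻¹ *F 0F            ≡⟨ cong (x ⁻¹ *F_) 0F⁻¹≡0F ⟨
        x ⁻¹ *F 0F ⁻¹         ∎
      both≢0 : x ≢ 0F → y ≢ 0F → (x *F y) ⁻¹ ≡ x ⁻¹ *F y ⁻¹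
      both≢0 x≢0 y≢0 = sym (⁻¹-unique (x *F y) (x ⁻¹ *F y ⁻¹) (begin
        (x *F y) *F (x ⁻¹ *F y ⁻¹)     ≡⟨ *F-interchange x y (x ⁻¹) (y ⁻¹) ⟩
        (x *F x ⁻¹) *F (y *F y ⁻¹)     ≡⟨ cong₂ _*F_ (*F-inverseʳ x x≢0) (*F-inverseʳ y y≢0) ⟩
        1F *F 1F                       ≡⟨ *F-identityˡ 1F ⟩
        1F                             ∎))

-- Character sums over 𝔽_p

module CharacterSums (p : ℕ) .{{_ : NonZero p}} (prime : Prime p) where

  open ℤMod p
  open Field prime

  pω : ℤω
  pω = fromℤ (+ p)

  ΣF : (Fin p → ℤω) → ℤω
  ΣF = Σω p

  ΣF-*F-invariant : ∀ (f : Fin p → ℤω) c → c ≢ 0F → ΣF f ≡ ΣF (λ x → f (c *F x))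
  ΣF-*F-invariant f c c≢0 = Σω-permute p f (c *F_) (c ⁻¹ *F_) (cancel c (c ⁻¹) (*F-inverseʳ c c≢0))
                                                      (cancel (c ⁻¹) c (*F-inverseˡ c c≢0))
    where
    cancel : ∀ a b → a *F b ≡ 1F → ∀ x → a *F (b *F x) ≡ x
    cancel a b ab≡1 x = trans (sym (*F-assoc a b x)) (trans (cong (_*F x) ab≡1) (*F-identityˡ x))

  ΣF-+F-invariant : ∀ (f : Fin p → ℤω) c → ΣF f ≡ ΣF (λ x → f (x +F c))
  ΣF-+F-invariant f c = Σω-permute p f (_+F c) (_+F -F c) (cancel (-F c) c (-F‿inverseˡ c))
                                                         (cancel c (-F c) (-F‿inverseʳ c))
    where
    cancel : ∀ a b → a +F b ≡ 0F → ∀ x → (x +F a) +F b ≡ x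
    cancel a b a+b≡0 x = trans (+F-assoc x a b) (trans (cong (x +F_) a+b≡0) (+F-identityʳ x))

  ΣF-⁻¹-invariant : ∀ (f : Fin p → ℤω) d → d ≢ 0F → ΣF f ≡ ΣF (λ u → f (d *F u ⁻¹))
  ΣF-⁻¹-invariant f d d≢0 = Σω-permute p f (λ u → d *F u ⁻¹) (λ u → d *F u ⁻¹) involutive involutive
    where
    open ≡-Reasoning
    involutive : ∀ u → d *F (d *F u ⁻¹) ⁻¹ ≡ u
    involutive u = begin
      d *F (d *F u ⁻¹) ⁻¹          ≡⟨ cong (d *F_) (⁻¹-distrib-*F d (u ⁻¹)) ⟩
      d *F (d ⁻¹ *F u ⁻¹ ⁻¹)       ≡⟨ *F-assoc d (d ⁻¹) (u ⁻¹ ⁻¹) ⟨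
      (d *F d ⁻¹) *F u ⁻¹ ⁻¹       ≡⟨ cong₂ _*F_ (*F-inverseʳ d d≢0) (⁻¹-involutive u) ⟩
      1F *F u                      ≡⟨ *F-identityˡ u ⟩
      u                            ∎

  δ₀ : Fin p → ℤω
  δ₀ x = Sum.[ (λ _ → 1ω) , (λ _ → 0ω) ]′ (≡0F⊎≢0F x)

  δ₀-0F : δ₀ 0F ≡ 1ω
  δ₀-0F with ≡0F⊎≢0F 0F
  ... | inj₁ _ = refl
  ... | inj₂ 0≢0 = ⊥-elim (0≢0 refl)

  δ₀-≢0F : ∀ x → x ≢ 0F → δ₀ x ≡ 0ω
  δ₀-≢0F x x≢0 with ≡0F⊎≢0F x
  ... | inj₁ x≡0 = ⊥-elim (x≢0 x≡0)
  ... | inj₂ _ = refl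

  ΣF-δ₀ : ΣF δ₀ ≡ 1ω
  ΣF-δ₀ = trans (Σω-single p δ₀ 0F δ₀-≢0F) δ₀-0F

  record IsUnitaryCharacter (A : Fin p → ℤω) : Set where
    field
      at-zero : A 0F ≡ 0ω
      at-one  : A 1F ≡ 1ω
      mult    : ∀ x y → A (x *F y) ≡ A x ⊗ A y
      unitary : ∀ x → x ≢ 0F → conj (A x) ⊗ A x ≡ 1ω

  open IsUnitaryCharacter

  order⇒unitary : ∀ m {A} → IsCharacterOfOrder p (suc m) A → IsUnitaryCharacter A
  order⇒unitary m {A} order = record
    { at-zero = IsCharacter.at-zero character
    ; at-one  = IsCharacter.at-one character
    ; mult    = λ x y → trans (cong A (sym (·F≡*F x y))) (IsCharacter.mult character x y)
    ; unitary = λ x x≢0 → unit⇒conj⊗self≡1 (A x) (A x ^ω m) (IsCharacterOfOrder.pow-k order x x≢0)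
    }
    where character = IsCharacterOfOrder.isChar order

  order⇒nontrivial : ∀ m {A} → IsCharacterOfOrder p (suc (suc m)) A → ∃[ x ] x ≢ 0F × A x ≢ 1ω
  order⇒nontrivial m {A} order with IsCharacterOfOrder.minimal order 1 (ℕ.s≤s ℕ.z≤n) (ℕ.s≤s (ℕ.s≤s ℕ.z≤n))
  ... | x , x≢0 , Ax^1≢1 = x , x≢0 , λ Ax≡1 → Ax^1≢1 (trans (⊗-identityʳ (A x)) Ax≡1)

  conj-unitary : ∀ {A} → IsUnitaryCharacter A → IsUnitaryCharacter (conj ∘ A)
  conj-unitary {A} χ = record
    { at-zero = cong conj (at-zero χ)
    ; at-one  = cong conj (at-one χ)
    ; mult    = λ x y → trans (cong conj (mult χ x y)) (conj-⊗ (A x) (A y))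
    ; unitary = λ x x≢0 → trans (cong (_⊗ conj (A x)) (conj-involutive (A x)))
                                (trans (⊗-comm (A x) (conj (A x))) (unitary χ x x≢0))
    }

  ⊗-unitary : ∀ {A B} → IsUnitaryCharacter A → IsUnitaryCharacter B → IsUnitaryCharacter (λ x → A x ⊗ B x)
  ⊗-unitary {A} {B} χ ψ = record
    { at-zero = trans (cong (_⊗ B 0F) (at-zero χ)) (⊗-zeroˡ (B 0F))
    ; at-one  = cong₂ _⊗_ (at-one χ) (at-one ψ)
    ; mult    = λ x y → trans (cong₂ _⊗_ (mult χ x y) (mult ψ x y)) (⊗-interchange (A x) (A y) (B x) (B y))
    ; unitary = λ x x≢0 → begin
        conj (A x ⊗ B x) ⊗ (A x ⊗ B x)           ≡⟨ cong (_⊗ (A x ⊗ B x)) (conj-⊗ (A x) (B x)) ⟩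
        (conj (A x) ⊗ conj (B x)) ⊗ (A x ⊗ B x)   ≡⟨ ⊗-interchange (conj (A x)) (conj (B x)) (A x) (B x) ⟩
        (conj (A x) ⊗ A x) ⊗ (conj (B x) ⊗ B x)   ≡⟨ cong₂ _⊗_ (unitary χ x x≢0) (unitary ψ x x≢0) ⟩
        1ω ⊗ 1ω                                  ≡⟨⟩
        1ω                                       ∎
    }
    where open ≡-Reasoning

  -- ΣA = A(x₀) ΣA by the substitution x ↦ x₀x, and A(x₀) ≠ 1
  ΣF-nontrivial≡0 : ∀ {A} → IsUnitaryCharacter A → ∃[ x ] x ≢ 0F × A x ≢ 1ω → ΣF A ≡ 0ω
  ΣF-nontrivial≡0 {A} χ (x₀ , x₀≢0 , Ax₀≢1) =
    Sum.[ (λ Ax₀-1≡0 → ⊥-elim (Ax₀≢1 (x⊖y≡0⇒x≡y (A x₀) 1ω Ax₀-1≡0))) , id ]′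
      (z⊗w≡0⇒z≡0∨w≡0 (A x₀ ⊕ ⊖ 1ω) (ΣF A) (begin
        (A x₀ ⊕ ⊖ 1ω) ⊗ ΣF A             ≡⟨ ⊗-distribʳ-⊖ (ΣF A) (A x₀) 1ω ⟩
        (A x₀ ⊗ ΣF A) ⊕ ⊖ (1ω ⊗ ΣF A)    ≡⟨ cong₂ (λ s t → s ⊕ ⊖ t) (sym ΣA≡Ax₀ΣA) (⊗-identityˡ (ΣF A)) ⟩
        ΣF A ⊕ ⊖ ΣF A                    ≡⟨ ⊖-inverseʳ (ΣF A) ⟩
        0ω                               ∎))
    where
    open ≡-Reasoning
    ΣA≡Ax₀ΣA : ΣF A ≡ A x₀ ⊗ ΣF A
    ΣA≡Ax₀ΣA = begin
      ΣF A                          ≡⟨ ΣF-*F-invariant A x₀ x₀≢0 ⟩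
      ΣF (λ x → A (x₀ *F x))        ≡⟨ Σω-cong p (mult χ x₀) ⟩
      ΣF (λ x → A x₀ ⊗ A x)         ≡⟨ Σω-distribˡ-⊗ p (A x₀) A ⟩
      A x₀ ⊗ ΣF A                   ∎

  ΣF-norm : ∀ {A} → IsUnitaryCharacter A → ΣF (λ x → conj (A x) ⊗ A x) ⊕ 1ω ≡ pω
  ΣF-norm {A} χ = begin
    ΣF (λ x → conj (A x) ⊗ A x) ⊕ 1ω          ≡⟨ cong (ΣF (λ x → conj (A x) ⊗ A x) ⊕_) ΣF-δ₀ ⟨
    ΣF (λ x → conj (A x) ⊗ A x) ⊕ ΣF δ₀       ≡⟨ Σω-distrib-⊕ p _ δ₀ ⟨
    ΣF (λ x → (conj (A x) ⊗ A x) ⊕ δ₀ x)      ≡⟨ Σω-cong p term≡1 ⟩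
    ΣF (λ _ → 1ω)                             ≡⟨ Σω-const-1 p ⟩
    pω                                        ∎
    where
    open ≡-Reasoning
    term≡1 : ∀ x → (conj (A x) ⊗ A x) ⊕ δ₀ x ≡ 1ω
    term≡1 x = Sum.[ zero-case , (λ x≢0 → cong₂ _⊕_ (unitary χ x x≢0) (δ₀-≢0F x x≢0)) ]′ (≡0F⊎≢0F x)
      where
      zero-case : x ≡ 0F → (conj (A x) ⊗ A x) ⊕ δ₀ x ≡ 1ω
      zero-case refl = cong₂ (λ a d → (conj a ⊗ a) ⊕ d) (at-zero χ) δ₀-0F

  -- for d ≢ 0, (u + d)/u = 1 + d u⁻¹ and u ↦ 1 + d u⁻¹ permutes Fin p, sending 0 to 1
  autocorrelation-≢0 : ∀ {B} → IsUnitaryCharacter B → ΣF B ≡ 0ω → ∀ d → d ≢ 0F →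
                       ΣF (λ u → conj (B u) ⊗ B (u +F d)) ⊕ 1ω ≡ 0ω
  autocorrelation-≢0 {B} ψ ΣB≡0 d d≢0 = begin
    ΣF (λ u → conj (B u) ⊗ B (u +F d)) ⊕ 1ω          ≡⟨ cong (ΣF (λ u → conj (B u) ⊗ B (u +F d)) ⊕_) ΣF-δ₀ ⟨
    ΣF (λ u → conj (B u) ⊗ B (u +F d)) ⊕ ΣF δ₀       ≡⟨ Σω-distrib-⊕ p _ δ₀ ⟨
    ΣF (λ u → (conj (B u) ⊗ B (u +F d)) ⊕ δ₀ u)      ≡⟨ Σω-cong p term≡ ⟩
    ΣF (λ u → B (1F +F d *F u ⁻¹))                   ≡⟨ ΣF-⁻¹-invariant (λ v → B (1F +F v)) d d≢0 ⟨
    ΣF (λ v → B (1F +F v))                           ≡⟨ Σω-cong p (λ v → cong B (+F-comm 1F v)) ⟩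
    ΣF (λ v → B (v +F 1F))                           ≡⟨ ΣF-+F-invariant B 1F ⟨
    ΣF B                                             ≡⟨ ΣB≡0 ⟩
    0ω                                               ∎
    where
    open ≡-Reasoning
    zero-case : (conj (B 0F) ⊗ B (0F +F d)) ⊕ δ₀ 0F ≡ B (1F +F d *F 0F ⁻¹)
    zero-case = begin
      (conj (B 0F) ⊗ B (0F +F d)) ⊕ δ₀ 0F   ≡⟨ cong₂ (λ b e → (conj b ⊗ B (0F +F d)) ⊕ e) (at-zero ψ) δ₀-0F ⟩
      (0ω ⊗ B (0F +F d)) ⊕ 1ω              ≡⟨ cong (_⊕ 1ω) (⊗-zeroˡ (B (0F +F d))) ⟩
      1ω                                   ≡⟨ at-one ψ ⟨
      B 1F                                 ≡⟨ cong B (+F-identityʳ 1F) ⟨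
      B (1F +F 0F)                         ≡⟨ cong (λ t → B (1F +F t)) (trans (cong (d *F_) 0F⁻¹≡0F) (*F-zeroʳ d)) ⟨
      B (1F +F d *F 0F ⁻¹)                 ∎
    term≡ : ∀ u → (conj (B u) ⊗ B (u +F d)) ⊕ δ₀ u ≡ B (1F +F d *F u ⁻¹)
    term≡ u = Sum.[ (λ { refl → zero-case }) , nonzero-case ]′ (≡0F⊎≢0F u)
      where
      nonzero-case : u ≢ 0F → (conj (B u) ⊗ B (u +F d)) ⊕ δ₀ u ≡ B (1F +F d *F u ⁻¹)
      nonzero-case u≢0 = begin
        (conj (B u) ⊗ B (u +F d)) ⊕ δ₀ u      ≡⟨ cong ((conj (B u) ⊗ B (u +F d)) ⊕_) (δ₀-≢0F u u≢0) ⟩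
        (conj (B u) ⊗ B (u +F d)) ⊕ 0ω        ≡⟨ ⊕-identityʳ _ ⟩
        conj (B u) ⊗ B (u +F d)               ≡⟨ cong (λ t → conj (B u) ⊗ B t) (x+d≡x[1+dx⁻¹] u d u≢0) ⟩
        conj (B u) ⊗ B (u *F w)               ≡⟨ cong (conj (B u) ⊗_) (mult ψ u w) ⟩
        conj (B u) ⊗ (B u ⊗ B w)              ≡⟨ ⊗-assoc (conj (B u)) (B u) (B w) ⟨
        (conj (B u) ⊗ B u) ⊗ B w              ≡⟨ cong (_⊗ B w) (unitary ψ u u≢0) ⟩
        1ω ⊗ B w                              ≡⟨ ⊗-identityˡ (B w) ⟩
        B w                                   ∎
        where w = 1F +F d *F u ⁻¹

  autocorrelation : ∀ {B} → IsUnitaryCharacter B → ΣF B ≡ 0ω → ∀ d →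
                    ΣF (λ u → conj (B u) ⊗ B (u +F d)) ⊕ 1ω ≡ pω ⊗ δ₀ d
  autocorrelation {B} ψ ΣB≡0 d = Sum.[ (λ { refl → zero-case }) , nonzero-case ]′ (≡0F⊎≢0F d)
    where
    zero-case : ΣF (λ u → conj (B u) ⊗ B (u +F 0F)) ⊕ 1ω ≡ pω ⊗ δ₀ 0F
    zero-case = trans (cong (_⊕ 1ω) (Σω-cong p (λ u → cong (λ t → conj (B u) ⊗ B t) (+F-identityʳ u))))
                      (trans (ΣF-norm ψ) (sym (trans (cong (pω ⊗_) δ₀-0F) (⊗-identityʳ pω))))
    nonzero-case : d ≢ 0F → ΣF (λ u → conj (B u) ⊗ B (u +F d)) ⊕ 1ω ≡ pω ⊗ δ₀ d
    nonzero-case d≢0 = trans (autocorrelation-≢0 ψ ΣB≡0 d d≢0)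
                             (sym (trans (cong (pω ⊗_) (δ₀-≢0F d d≢0)) (⊗-zeroʳ pω)))

  jacobi : (Fin p → ℤω) → (Fin p → ℤω) → ℤω
  jacobi A B = ΣF (λ x → A x ⊗ B (1F +F -F x))

  -- Σ_c |T c|² with T c = Σ_x A(x) B(c - x) is computed in two ways:
  -- T c = A(c) B(c) J for c ≢ 0 and T 0 = 0 give (p - 1)|J|², expanding gives (p - 1) p.
  module JacobiNorm {A B} (χ : IsUnitaryCharacter A) (ψ : IsUnitaryCharacter B)
                    (ΣA≡0 : ΣF A ≡ 0ω) (ΣB≡0 : ΣF B ≡ 0ω) (ΣAB≡0 : ΣF (λ x → A x ⊗ B x) ≡ 0ω) where

    open ≡-Reasoning

    J |J|² : ℤω
    J = jacobi A B
    |J|² = conj J ⊗ J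

    T : Fin p → ℤω
    T c = ΣF (λ x → A x ⊗ B (c +F -F x))

    |T|² : Fin p → ℤω
    |T|² c = conj (T c) ⊗ T c

    T-≢0 : ∀ c → c ≢ 0F → T c ≡ (A c ⊗ B c) ⊗ J
    T-≢0 c c≢0 = begin
      T c                                             ≡⟨ ΣF-*F-invariant (λ x → A x ⊗ B (c +F -F x)) c c≢0 ⟩
      ΣF (λ x → A (c *F x) ⊗ B (c +F -F (c *F x)))    ≡⟨ Σω-cong p term≡ ⟩
      ΣF (λ x → (A c ⊗ B c) ⊗ (A x ⊗ B (1F +F -F x))) ≡⟨ Σω-distribˡ-⊗ p (A c ⊗ B c) _ ⟩
      (A c ⊗ B c) ⊗ J                                 ∎
      where
      c-cx≡c[1-x] : ∀ x → c +F -F (c *F x) ≡ c *F (1F +F -F x)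
      c-cx≡c[1-x] x = sym (trans (*F-distribˡ-+F c 1F (-F x))
                                 (cong₂ _+F_ (*F-identityʳ c) (sym (-F‿distribʳ-*F c x))))
      term≡ : ∀ x → A (c *F x) ⊗ B (c +F -F (c *F x)) ≡ (A c ⊗ B c) ⊗ (A x ⊗ B (1F +F -F x))
      term≡ x = trans (cong₂ _⊗_ (mult χ c x) (trans (cong B (c-cx≡c[1-x] x)) (mult ψ c (1F +F -F x))))
                      (⊗-interchange (A c) (A x) (B c) (B (1F +F -F x)))

    T-0 : T 0F ≡ 0ω
    T-0 = begin
      T 0F                                  ≡⟨ Σω-cong p term≡ ⟩
      ΣF (λ x → B (-F 1F) ⊗ (A x ⊗ B x))    ≡⟨ Σω-distribˡ-⊗ p (B (-F 1F)) _ ⟩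
      B (-F 1F) ⊗ ΣF (λ x → A x ⊗ B x)      ≡⟨ cong (B (-F 1F) ⊗_) ΣAB≡0 ⟩
      B (-F 1F) ⊗ 0ω                        ≡⟨ ⊗-zeroʳ (B (-F 1F)) ⟩
      0ω                                    ∎
      where
      term≡ : ∀ x → A x ⊗ B (0F +F -F x) ≡ B (-F 1F) ⊗ (A x ⊗ B x)
      term≡ x = trans (cong (λ t → A x ⊗ B t) (trans (+F-identityˡ (-F x)) (sym (-1*x≡-x x))))
                      (trans (cong (A x ⊗_) (mult ψ (-F 1F) x)) (x⊗yz≡y⊗xz (A x) (B (-F 1F)) (B x)))

    |T|²⊕δ₀|J|² : ∀ c → |T|² c ⊕ (δ₀ c ⊗ |J|²) ≡ |J|²
    |T|²⊕δ₀|J|² c = Sum.[ (λ { refl → zero-case }) , nonzero-case ]′ (≡0F⊎≢0F c)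
      where
      zero-case : |T|² 0F ⊕ (δ₀ 0F ⊗ |J|²) ≡ |J|²
      zero-case = begin
        |T|² 0F ⊕ (δ₀ 0F ⊗ |J|²)          ≡⟨ cong₂ (λ t d → (conj t ⊗ t) ⊕ (d ⊗ |J|²)) T-0 δ₀-0F ⟩
        (conj 0ω ⊗ 0ω) ⊕ (1ω ⊗ |J|²)      ≡⟨ ⊕-identityˡ (1ω ⊗ |J|²) ⟩
        1ω ⊗ |J|²                         ≡⟨ ⊗-identityˡ |J|² ⟩
        |J|²                              ∎
      nonzero-case : c ≢ 0F → |T|² c ⊕ (δ₀ c ⊗ |J|²) ≡ |J|²
      nonzero-case c≢0 = begin
        |T|² c ⊕ (δ₀ c ⊗ |J|²)                     ≡⟨ cong₂ (λ t d → (conj t ⊗ t) ⊕ (d ⊗ |J|²)) (T-≢0 c c≢0) (δ₀-≢0F c c≢0) ⟩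
        (conj (AB ⊗ J) ⊗ (AB ⊗ J)) ⊕ (0ω ⊗ |J|²)   ≡⟨ cong₂ _⊕_ |ABJ|²≡ (⊗-zeroˡ |J|²) ⟩
        ((conj AB ⊗ AB) ⊗ |J|²) ⊕ 0ω               ≡⟨ ⊕-identityʳ _ ⟩
        (conj AB ⊗ AB) ⊗ |J|²                      ≡⟨ cong (_⊗ |J|²) (unitary (⊗-unitary χ ψ) c c≢0) ⟩
        1ω ⊗ |J|²                                  ≡⟨ ⊗-identityˡ |J|² ⟩
        |J|²                                       ∎
        where
        AB = A c ⊗ B c
        |ABJ|²≡ : conj (AB ⊗ J) ⊗ (AB ⊗ J) ≡ (conj AB ⊗ AB) ⊗ |J|²
        |ABJ|²≡ = trans (cong (_⊗ (AB ⊗ J)) (conj-⊗ AB J)) (⊗-interchange (conj AB) (conj J) AB J)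

    Σ|T|²⊕|J|²≡p|J|² : ΣF |T|² ⊕ |J|² ≡ pω ⊗ |J|²
    Σ|T|²⊕|J|²≡p|J|² = begin
      ΣF |T|² ⊕ |J|²                              ≡⟨ cong (ΣF |T|² ⊕_) ΣF-δ₀|J|² ⟨
      ΣF |T|² ⊕ ΣF (λ c → δ₀ c ⊗ |J|²)            ≡⟨ Σω-distrib-⊕ p |T|² _ ⟨
      ΣF (λ c → |T|² c ⊕ (δ₀ c ⊗ |J|²))           ≡⟨ Σω-cong p |T|²⊕δ₀|J|² ⟩
      ΣF (λ _ → |J|²)                             ≡⟨ Σω-cong p (λ _ → ⊗-identityˡ |J|²) ⟨
      ΣF (λ _ → 1ω ⊗ |J|²)                        ≡⟨ Σω-distribʳ-⊗ p |J|² (λ _ → 1ω) ⟩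
      ΣF (λ _ → 1ω) ⊗ |J|²                        ≡⟨ cong (_⊗ |J|²) (Σω-const-1 p) ⟩
      pω ⊗ |J|²                                   ∎
      where
      ΣF-δ₀|J|² : ΣF (λ c → δ₀ c ⊗ |J|²) ≡ |J|²
      ΣF-δ₀|J|² = trans (Σω-distribʳ-⊗ p |J|² δ₀) (trans (cong (_⊗ |J|²) ΣF-δ₀) (⊗-identityˡ |J|²))

    |A|² : Fin p → ℤω
    |A|² y = conj (A y) ⊗ A y

    G : Fin p → Fin p → Fin p → ℤω
    G c y x = (conj (A y) ⊗ A x) ⊗ (conj (B (c +F -F y)) ⊗ B (c +F -F x))

    |T|²-expand : ∀ c → |T|² c ≡ ΣF (λ y → ΣF (λ x → G c y x))
    |T|²-expand c = begin
      conj (T c) ⊗ T c                                  ≡⟨ cong (_⊗ T c) (Σω-conj p (λ y → A y ⊗ B (c +F -F y))) ⟨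
      ΣF (λ y → conj (A y ⊗ B (c +F -F y))) ⊗ T c        ≡⟨ Σω-distribʳ-⊗ p (T c) _ ⟨
      ΣF (λ y → conj (A y ⊗ B (c +F -F y)) ⊗ T c)        ≡⟨ Σω-cong p (λ y → Σω-distribˡ-⊗ p (conj (A y ⊗ B (c +F -F y))) (λ x → A x ⊗ B (c +F -F x))) ⟨
      ΣF (λ y → ΣF (λ x → conj (A y ⊗ B (c +F -F y)) ⊗ (A x ⊗ B (c +F -F x))))
                                                        ≡⟨ Σω-cong p (λ y → Σω-cong p (λ x → term≡ y x)) ⟩
      ΣF (λ y → ΣF (λ x → G c y x))                     ∎
      where
      term≡ : ∀ y x → conj (A y ⊗ B (c +F -F y)) ⊗ (A x ⊗ B (c +F -F x)) ≡ G c y x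
      term≡ y x = trans (cong (_⊗ (A x ⊗ B (c +F -F x))) (conj-⊗ (A y) (B (c +F -F y))))
                        (⊗-interchange (conj (A y)) (conj (B (c +F -F y))) (A x) (B (c +F -F x)))

    K : Fin p → Fin p → ℤω
    K y x = ΣF (λ c → conj (B (c +F -F y)) ⊗ B (c +F -F x))

    K⊕1 : ∀ y x → K y x ⊕ 1ω ≡ pω ⊗ δ₀ (y +F -F x)
    K⊕1 y x = trans (cong (_⊕ 1ω) shift) (autocorrelation ψ ΣB≡0 (y +F -F x))
      where
      shift : K y x ≡ ΣF (λ c → conj (B c) ⊗ B (c +F (y +F -F x)))
      shift = trans (ΣF-+F-invariant _ y) (Σω-cong p (λ c → cong₂ (λ s t → conj (B s) ⊗ B t)
                (trans (+F-assoc c y (-F y)) (trans (cong (c +F_) (-F‿inverseʳ y)) (+F-identityʳ c)))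
                (+F-assoc c y (-F x))))

    diagonal : ∀ y → ΣF (λ x → (conj (A y) ⊗ A x) ⊗ (pω ⊗ δ₀ (y +F -F x))) ≡ |A|² y ⊗ pω
    diagonal y = begin
      ΣF (λ x → (conj (A y) ⊗ A x) ⊗ (pω ⊗ δ₀ (y +F -F x)))   ≡⟨ Σω-single p _ y off-diagonal ⟩
      |A|² y ⊗ (pω ⊗ δ₀ (y +F -F y))                          ≡⟨ cong (λ t → |A|² y ⊗ (pω ⊗ δ₀ t)) (-F‿inverseʳ y) ⟩
      |A|² y ⊗ (pω ⊗ δ₀ 0F)                                   ≡⟨ cong (λ t → |A|² y ⊗ (pω ⊗ t)) δ₀-0F ⟩
      |A|² y ⊗ (pω ⊗ 1ω)                                      ≡⟨ cong (|A|² y ⊗_) (⊗-identityʳ pω) ⟩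
      |A|² y ⊗ pω                                             ∎
      where
      off-diagonal : ∀ x → x ≢ y → (conj (A y) ⊗ A x) ⊗ (pω ⊗ δ₀ (y +F -F x)) ≡ 0ω
      off-diagonal x x≢y = trans (cong (λ t → (conj (A y) ⊗ A x) ⊗ (pω ⊗ t)) (δ₀-≢0F _ y-x≢0))
                                 (trans (cong ((conj (A y) ⊗ A x) ⊗_) (⊗-zeroʳ pω)) (⊗-zeroʳ (conj (A y) ⊗ A x)))
        where
        y-x≢0 : y +F -F x ≢ 0F
        y-x≢0 y-x≡0 = x≢y (sym (trans (x-y≡0⇒x≡y y x y-x≡0) refl))

    Σ|T|²≡Σ|A|²⊗p : ΣF |T|² ≡ ΣF |A|² ⊗ pω
    Σ|T|²≡Σ|A|²⊗p = ⊕-cancelʳ Z _ _ (begin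
      ΣF |T|² ⊕ Z                                                   ≡⟨ cong (_⊕ Z) (Σω-cong p |T|²-expand) ⟩
      ΣF (λ c → ΣF (λ y → ΣF (λ x → G c y x))) ⊕ Z                  ≡⟨ cong (_⊕ Z) (Σω-comm p p _) ⟩
      ΣF (λ y → ΣF (λ c → ΣF (λ x → G c y x))) ⊕ Z                  ≡⟨ cong (_⊕ Z) (Σω-cong p (λ y → Σω-comm p p _)) ⟩
      ΣF (λ y → ΣF (λ x → ΣF (λ c → G c y x))) ⊕ Z                  ≡⟨ cong (_⊕ Z) (Σω-cong p (λ y → Σω-cong p (λ x → Σω-distribˡ-⊗ p (conj (A y) ⊗ A x) (λ c → conj (B (c +F -F y)) ⊗ B (c +F -F x))))) ⟩
      ΣF (λ y → ΣF (λ x → (conj (A y) ⊗ A x) ⊗ K y x)) ⊕ Z          ≡⟨ Σω-distrib-⊕ p _ _ ⟨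
      ΣF (λ y → ΣF (λ x → (conj (A y) ⊗ A x) ⊗ K y x) ⊕ ΣF (λ x → conj (A y) ⊗ A x))
                                                                    ≡⟨ Σω-cong p (λ y → Σω-distrib-⊕ p _ _) ⟨
      ΣF (λ y → ΣF (λ x → ((conj (A y) ⊗ A x) ⊗ K y x) ⊕ (conj (A y) ⊗ A x)))
                                                                    ≡⟨ Σω-cong p (λ y → Σω-cong p (λ x → term≡ y x)) ⟩
      ΣF (λ y → ΣF (λ x → (conj (A y) ⊗ A x) ⊗ (pω ⊗ δ₀ (y +F -F x)))) ≡⟨ Σω-cong p diagonal ⟩
      ΣF (λ y → |A|² y ⊗ pω)                                        ≡⟨ Σω-distribʳ-⊗ p pω |A|² ⟩
      ΣF |A|² ⊗ pω                                                  ≡⟨ ⊕-identityʳ _ ⟨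
      (ΣF |A|² ⊗ pω) ⊕ 0ω                                           ≡⟨ cong ((ΣF |A|² ⊗ pω) ⊕_) Z≡0 ⟨
      (ΣF |A|² ⊗ pω) ⊕ Z                                            ∎)
      where
      Z : ℤω
      Z = ΣF (λ y → ΣF (λ x → conj (A y) ⊗ A x))
      Z≡0 : Z ≡ 0ω
      Z≡0 = Σω-zero p _ (λ y → trans (Σω-distribˡ-⊗ p (conj (A y)) A)
                                    (trans (cong (conj (A y) ⊗_) ΣA≡0) (⊗-zeroʳ (conj (A y)))))
      term≡ : ∀ y x → ((conj (A y) ⊗ A x) ⊗ K y x) ⊕ (conj (A y) ⊗ A x)
                    ≡ (conj (A y) ⊗ A x) ⊗ (pω ⊗ δ₀ (y +F -F x))
      term≡ y x = begin
        (w ⊗ K y x) ⊕ w          ≡⟨ cong ((w ⊗ K y x) ⊕_) (⊗-identityʳ w) ⟨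
        (w ⊗ K y x) ⊕ (w ⊗ 1ω)   ≡⟨ ⊗-distribˡ-⊕ w (K y x) 1ω ⟨
        w ⊗ (K y x ⊕ 1ω)         ≡⟨ cong (w ⊗_) (K⊕1 y x) ⟩
        w ⊗ (pω ⊗ δ₀ (y +F -F x)) ∎
        where w = conj (A y) ⊗ A x

    |J|²≡p : |J|² ≡ pω
    |J|²≡p = ⊗-cancelˡ (pω ⊕ ⊖ 1ω) |J|² pω p-1≢0 (begin
      (pω ⊕ ⊖ 1ω) ⊗ |J|²                ≡⟨ ⊗-distribʳ-⊖ |J|² pω 1ω ⟩
      (pω ⊗ |J|²) ⊕ ⊖ (1ω ⊗ |J|²)       ≡⟨ cong (λ t → (pω ⊗ |J|²) ⊕ ⊖ t) (⊗-identityˡ |J|²) ⟩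
      (pω ⊗ |J|²) ⊕ ⊖ |J|²              ≡⟨ x⊕y≡z⇒x≡z⊖y (ΣF |T|²) |J|² _ Σ|T|²⊕|J|²≡p|J|² ⟨
      ΣF |T|²                          ≡⟨ Σ|T|²≡Σ|A|²⊗p ⟩
      ΣF |A|² ⊗ pω                      ≡⟨ cong (_⊗ pω) (x⊕y≡z⇒x≡z⊖y (ΣF |A|²) 1ω pω (ΣF-norm χ)) ⟩
      (pω ⊕ ⊖ 1ω) ⊗ pω                  ∎)
      where
      p-1≢0 : pω ⊕ ⊖ 1ω ≢ 0ω
      p-1≢0 p-1≡0 = ℕ.<⇒≢ 1<p (sym (ℤ.+-injective (ℤ.i-j≡0⇒i≡j (+ p) (+ 1) (cong ℤω.a p-1≡0))))

  jacobi-norm : ∀ {A B} → IsUnitaryCharacter A → IsUnitaryCharacter B →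
                ΣF A ≡ 0ω → ΣF B ≡ 0ω → ΣF (λ x → A x ⊗ B x) ≡ 0ω → conj (jacobi A B) ⊗ jacobi A B ≡ pω
  jacobi-norm χ ψ ΣA≡0 ΣB≡0 ΣAB≡0 = JacobiNorm.|J|²≡p χ ψ ΣA≡0 ΣB≡0 ΣAB≡0

-- Integers inside ℚ

ι : ℤ → ℚ
ι i = i / 1

ι-+ : ∀ i j → ι i ℚ.+ ι j ≡ ι (i + j)
ι-+ i j = ℚ.toℚᵘ-injective (ℚᵘ.≃-trans (ℚ.toℚᵘ-homo-+ (ι i) (ι j))
  (ℚᵘ.≃-trans (ℚᵘ.+-cong (ℚ.toℚᵘ-fromℚᵘ (ℚᵘ.mkℚᵘ i 0)) (ℚ.toℚᵘ-fromℚᵘ (ℚᵘ.mkℚᵘ j 0)))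
    (ℚᵘ.≃-trans (ℚᵘ.*≡* (identity i j)) (ℚᵘ.≃-sym (ℚ.toℚᵘ-fromℚᵘ (ℚᵘ.mkℚᵘ (i + j) 0))))))
  where
  identity : ∀ i j → (i * + 1 + j * + 1) * + 1 ≡ (i + j) * + 1
  identity = ℤ-Solver.solve-∀

ι-neg : ∀ i → ℚ.- ι i ≡ ι (- i)
ι-neg i = ℚ.toℚᵘ-injective (ℚᵘ.≃-trans (ℚ.toℚᵘ-homo‿- (ι i))
  (ℚᵘ.≃-trans (ℚᵘ.-‿cong (ℚ.toℚᵘ-fromℚᵘ (ℚᵘ.mkℚᵘ i 0))) (ℚᵘ.≃-sym (ℚ.toℚᵘ-fromℚᵘ (ℚᵘ.mkℚᵘ (- i) 0)))))

p*[i/p]≡ι[i] : ∀ p .{{_ : NonZero p}} i → (+ p / 1) ℚ.* (i / p) ≡ ι i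
p*[i/p]≡ι[i] (suc m) i = ℚ.toℚᵘ-injective (ℚᵘ.≃-trans (ℚ.toℚᵘ-homo-* (+ suc m / 1) (i / suc m))
  (ℚᵘ.≃-trans (ℚᵘ.*-cong (ℚ.toℚᵘ-fromℚᵘ (ℚᵘ.mkℚᵘ (+ suc m) 0)) (ℚ.toℚᵘ-fromℚᵘ (ℚᵘ.mkℚᵘ i m)))
    (ℚᵘ.≃-trans (ℚᵘ.*≡* cross-multiplied) (ℚᵘ.≃-sym (ℚ.toℚᵘ-fromℚᵘ (ℚᵘ.mkℚᵘ i 0))))))
  where
  cross-multiplied : (+ suc m * i) * + 1 ≡ i * + suc (m ℕ.+ 0)
  cross-multiplied rewrite ℕ.+-identityʳ m = identity (+ suc m) i
    where
    identity : ∀ a i → (a * i) * + 1 ≡ i * a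
    identity = ℤ-Solver.solve-∀

ι[2w]*½≡ι[w] : ∀ w → ι (+ 2 * w) ℚ.* ½ ≡ ι w
ι[2w]*½≡ι[w] w = ℚ.toℚᵘ-injective (ℚᵘ.≃-trans (ℚ.toℚᵘ-homo-* (ι (+ 2 * w)) ½)
  (ℚᵘ.≃-trans (ℚᵘ.*-cong (ℚ.toℚᵘ-fromℚᵘ (ℚᵘ.mkℚᵘ (+ 2 * w) 0)) (ℚᵘ.≃-refl {ℚᵘ.mkℚᵘ (+ 1) 1}))
    (ℚᵘ.≃-trans (ℚᵘ.*≡* (identity w)) (ℚᵘ.≃-sym (ℚ.toℚᵘ-fromℚᵘ (ℚᵘ.mkℚᵘ w 0))))))
  where
  identity : ∀ w → (+ 2 * w * + 1) * + 1 ≡ w * + 2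
  identity = ℤ-Solver.solve-∀

p*Re≡u-w : ∀ p .{{_ : NonZero p}} u w → (+ p / 1) ℚ.* Re (u / p) (+ 2 * w / p) ≡ ι (u - w)
p*Re≡u-w p u w = begin
  P ℚ.* (u / p ℚ.- (+ 2 * w / p) ℚ.* ½)             ≡⟨ distrib P (u / p) (+ 2 * w / p) ½ ⟩
  P ℚ.* (u / p) ℚ.- (P ℚ.* (+ 2 * w / p)) ℚ.* ½     ≡⟨ cong₂ (λ s t → s ℚ.- t ℚ.* ½) (p*[i/p]≡ι[i] p u) (p*[i/p]≡ι[i] p (+ 2 * w)) ⟩
  ι u ℚ.- ι (+ 2 * w) ℚ.* ½                         ≡⟨ cong (λ t → ι u ℚ.- t) (ι[2w]*½≡ι[w] w) ⟩
  ι u ℚ.- ι w                                       ≡⟨ cong (ι u ℚ.+_) (ι-neg w) ⟩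
  ι u ℚ.+ ι (- w)                                   ≡⟨ ι-+ u (- w) ⟩
  ι (u - w)                                         ∎
  where
  open ≡-Reasoning
  P = + p / 1
  distrib : ∀ P x y h → P ℚ.* (x ℚ.- y ℚ.* h) ≡ P ℚ.* x ℚ.- (P ℚ.* y) ℚ.* h
  distrib = solve 4 (λ P x y h → P :* (x :- y :* h) := P :* x :- (P :* y) :* h) refl
    where open +-*-Solver

-- The Jacobi sums of a cubic character

module CubicJacobiSums (p : ℕ) .{{_ : NonZero p}} (prime : Prime p) {χ φ : Fin p → ℤω}
                       (order₃ : IsCharacterOfOrder p 3 χ) (order₂ : IsCharacterOfOrder p 2 φ) where

  open ℤMod p
  open Field prime
  open CharacterSums p prime
  open IsUnitaryCharacter
  open ≡-Reasoning

  χ̄ φχ : Fin p → ℤω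
  χ̄ = conj ∘ χ
  φχ = φ ·χ χ

  unitary-χ : IsUnitaryCharacter χ
  unitary-χ = order⇒unitary 2 order₃

  unitary-φ : IsUnitaryCharacter φ
  unitary-φ = order⇒unitary 1 order₂

  unitary-χ̄ : IsUnitaryCharacter χ̄
  unitary-χ̄ = conj-unitary unitary-χ

  unitary-φχ : IsUnitaryCharacter φχ
  unitary-φχ = ⊗-unitary unitary-φ unitary-χ

  χ³≡1 : ∀ x → x ≢ 0F → χ x ^ω 3 ≡ 1ω
  χ³≡1 = IsCharacterOfOrder.pow-k order₃

  φ²≡1 : ∀ x → x ≢ 0F → φ x ^ω 2 ≡ 1ω
  φ²≡1 = IsCharacterOfOrder.pow-k order₂

  χ-1≡1 : χ (-F 1F) ≡ 1ω
  χ-1≡1 = z³≡1∧z²≡1⇒z≡1 (χ³≡1 (-F 1F) -1≢0) (begin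
    χ (-F 1F) ⊗ (χ (-F 1F) ⊗ 1ω)   ≡⟨ cong (χ (-F 1F) ⊗_) (⊗-identityʳ (χ (-F 1F))) ⟩
    χ (-F 1F) ⊗ χ (-F 1F)          ≡⟨ mult unitary-χ (-F 1F) (-F 1F) ⟨
    χ (-F 1F *F -F 1F)             ≡⟨ cong χ -1*-1≡1 ⟩
    χ 1F                           ≡⟨ at-one unitary-χ ⟩
    1ω                             ∎)

  Σχ≡0 : ΣF χ ≡ 0ω
  Σχ≡0 = ΣF-nontrivial≡0 unitary-χ (order⇒nontrivial 1 order₃)

  Σφ≡0 : ΣF φ ≡ 0ω
  Σφ≡0 = ΣF-nontrivial≡0 unitary-φ (order⇒nontrivial 0 order₂)

  Σφχ≡0 : ΣF φχ ≡ 0ω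
  Σφχ≡0 = let (x₀ , x₀≢0 , χx₀≢1) = order⇒nontrivial 1 order₃ in
    ΣF-nontrivial≡0 unitary-φχ (x₀ , x₀≢0 , φχx₀≢1 x₀ x₀≢0 χx₀≢1)
    where
    φχx₀≢1 : ∀ x₀ → x₀ ≢ 0F → χ x₀ ≢ 1ω → φχ x₀ ≢ 1ω
    φχx₀≢1 x₀ x₀≢0 χx₀≢1 φχx₀≡1 = χx₀≢1 (z³≡1∧z²≡1⇒z≡1 (χ³≡1 x₀ x₀≢0) (begin
      χ x₀ ^ω 2                         ≡⟨ ⊗-identityˡ (χ x₀ ^ω 2) ⟨
      1ω ⊗ (χ x₀ ^ω 2)                  ≡⟨ cong (_⊗ (χ x₀ ^ω 2)) (φ²≡1 x₀ x₀≢0) ⟨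
      (φ x₀ ^ω 2) ⊗ (χ x₀ ^ω 2)         ≡⟨ ^ω-distrib-⊗ (φ x₀) (χ x₀) 2 ⟨
      φχ x₀ ^ω 2                        ≡⟨ cong (_^ω 2) φχx₀≡1 ⟩
      1ω                                ∎))

  Σχ̄≡0 : ΣF χ̄ ≡ 0ω
  Σχ̄≡0 = trans (Σω-conj p χ) (cong conj Σχ≡0)

  χ̄-1≡1 : χ̄ (-F 1F) ≡ 1ω
  χ̄-1≡1 = cong conj χ-1≡1

  Σχχ̄≡-1 : ΣF (λ x → χ x ⊗ χ̄ (oneMinus p x)) ≡ ⊖ 1ω
  Σχχ̄≡-1 = trans (Σω-cong p term≡) (trans (x⊕y≡z⇒x≡z⊖y _ 1ω 0ω autocorrelation-at-1) (⊕-identityˡ (⊖ 1ω)))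
    where
    autocorrelation-at-1 : ΣF (λ u → conj (χ̄ u) ⊗ χ̄ (u +F -F 1F)) ⊕ 1ω ≡ 0ω
    autocorrelation-at-1 = autocorrelation-≢0 unitary-χ̄ Σχ̄≡0 (-F 1F) -1≢0
    term≡ : ∀ u → χ u ⊗ χ̄ (oneMinus p u) ≡ conj (χ̄ u) ⊗ χ̄ (u +F -F 1F)
    term≡ u = cong₂ _⊗_ (sym (conj-involutive (χ u))) (begin
      χ̄ (oneMinus p u)                        ≡⟨ cong χ̄ (trans (oneMinus≡1-x u) (1-x≡-1*[x-1] u)) ⟩
      χ̄ (-F 1F *F (u +F -F 1F))               ≡⟨ mult unitary-χ̄ (-F 1F) (u +F -F 1F) ⟩
      χ̄ (-F 1F) ⊗ χ̄ (u +F -F 1F)              ≡⟨ cong (_⊗ χ̄ (u +F -F 1F)) χ̄-1≡1 ⟩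
      1ω ⊗ χ̄ (u +F -F 1F)                     ≡⟨ ⊗-identityˡ (χ̄ (u +F -F 1F)) ⟩
      χ̄ (u +F -F 1F)                          ∎)

  pBinom-χ-χ≡-1 : pBinom p χ χ ≡ ⊖ 1ω
  pBinom-χ-χ≡-1 = cong₂ _⊗_ (trans (cong χ minusOneF≡-1F) χ-1≡1) Σχχ̄≡-1

  Jφχ : ℤω
  Jφχ = ΣF (λ x → φχ x ⊗ χ̄ (oneMinus p x))

  pBinom-φχ-χ≡Jφχ : pBinom p φχ χ ≡ Jφχ
  pBinom-φχ-χ≡Jφχ = trans (cong (_⊗ Jφχ) (trans (cong χ minusOneF≡-1F) χ-1≡1)) (⊗-identityˡ Jφχ)

  |Jφχ|²≡p : conj Jφχ ⊗ Jφχ ≡ pω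
  |Jφχ|²≡p = trans (cong (λ t → conj t ⊗ t) Jφχ≡jacobi)
                     (jacobi-norm unitary-φχ unitary-χ̄ Σφχ≡0 Σχ̄≡0 (trans (Σω-cong p φχχ̄≡φ) Σφ≡0))
    where
    Jφχ≡jacobi : Jφχ ≡ jacobi φχ χ̄
    Jφχ≡jacobi = Σω-cong p (λ x → cong (λ t → φχ x ⊗ χ̄ t) (oneMinus≡1-x x))
    φχχ̄≡φ : ∀ x → φχ x ⊗ χ̄ x ≡ φ x
    φχχ̄≡φ x = Sum.[ (λ { refl → zero-case }) , nonzero-case ]′ (≡0F⊎≢0F x)
      where
      zero-case : φχ 0F ⊗ χ̄ 0F ≡ φ 0F
      zero-case = begin
        (φ 0F ⊗ χ 0F) ⊗ conj (χ 0F)   ≡⟨ cong (λ t → (φ 0F ⊗ t) ⊗ conj t) (at-zero unitary-χ) ⟩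
        (φ 0F ⊗ 0ω) ⊗ conj 0ω         ≡⟨ ⊗-zeroʳ (φ 0F ⊗ 0ω) ⟩
        0ω                            ≡⟨ at-zero unitary-φ ⟨
        φ 0F                          ∎
      nonzero-case : x ≢ 0F → φχ x ⊗ χ̄ x ≡ φ x
      nonzero-case x≢0 = begin
        (φ x ⊗ χ x) ⊗ conj (χ x)      ≡⟨ ⊗-assoc (φ x) (χ x) (conj (χ x)) ⟩
        φ x ⊗ (χ x ⊗ conj (χ x))      ≡⟨ cong (φ x ⊗_) (⊗-comm (χ x) (conj (χ x))) ⟩
        φ x ⊗ (conj (χ x) ⊗ χ x)      ≡⟨ cong (φ x ⊗_) (unitary unitary-χ x x≢0) ⟩
        φ x ⊗ 1ω                      ≡⟨ ⊗-identityʳ (φ x) ⟩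
        φ x                           ∎

  φχχ̄≡χχ̄[mod2] : ∀ x → φχ x ⊗ χ̄ (oneMinus p x) ≡ χ x ⊗ χ̄ (oneMinus p x) [mod two ]
  φχχ̄≡χχ̄[mod2] x = Sum.[ (λ { refl → zero-case }) , nonzero-case ]′ (≡0F⊎≢0F x)
    where
    c = χ̄ (oneMinus p x)
    zero-case : φχ 0F ⊗ χ̄ (oneMinus p 0F) ≡ χ 0F ⊗ χ̄ (oneMinus p 0F) [mod two ]
    zero-case = ≡⇒≡[mod] two (begin
      (φ 0F ⊗ χ 0F) ⊗ χ̄ (oneMinus p 0F)   ≡⟨ cong (λ t → (φ 0F ⊗ t) ⊗ χ̄ (oneMinus p 0F)) (at-zero unitary-χ) ⟩
      (φ 0F ⊗ 0ω) ⊗ χ̄ (oneMinus p 0F)     ≡⟨ cong (_⊗ χ̄ (oneMinus p 0F)) (⊗-zeroʳ (φ 0F)) ⟩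
      0ω ⊗ χ̄ (oneMinus p 0F)              ≡⟨ cong (_⊗ χ̄ (oneMinus p 0F)) (at-zero unitary-χ) ⟨
      χ 0F ⊗ χ̄ (oneMinus p 0F)            ∎)
    nonzero-case : x ≢ 0F → φχ x ⊗ c ≡ χ x ⊗ c [mod two ]
    nonzero-case x≢0 = subst₂ (λ s t → s ≡ t [mod two ])
      (sym (⊗-assoc (φ x) (χ x) c)) (⊗-identityˡ (χ x ⊗ c))
      ([mod]-⊗ (±1≡1[mod2] (z²≡1⇒z≡±1 (φ x) (φ²≡1 x x≢0))) (≡⇒≡[mod] {χ x ⊗ c} two refl))

  Jφχ≡-1[mod2] : Jφχ ≡ ⊖ 1ω [mod two ]
  Jφχ≡-1[mod2] = subst (λ t → Jφχ ≡ t [mod two ]) Σχχ̄≡-1 (Σω-cong-mod p two φχχ̄≡χχ̄[mod2])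

  δ₁ : Fin p → ℤω
  δ₁ x = δ₀ (oneMinus p x)

  Σφ[1-δ₁]≡-1 : ΣF (λ x → φ x ⊗ (1ω ⊕ ⊖ δ₁ x)) ≡ ⊖ 1ω
  Σφ[1-δ₁]≡-1 = trans (x⊕y≡z⇒x≡z⊖y _ 1ω 0ω (begin
    ΣF (λ x → φ x ⊗ (1ω ⊕ ⊖ δ₁ x)) ⊕ 1ω                          ≡⟨ cong (ΣF (λ x → φ x ⊗ (1ω ⊕ ⊖ δ₁ x)) ⊕_) Σφδ₁≡1 ⟨
    ΣF (λ x → φ x ⊗ (1ω ⊕ ⊖ δ₁ x)) ⊕ ΣF (λ x → φ x ⊗ δ₁ x)        ≡⟨ Σω-distrib-⊕ p _ _ ⟨
    ΣF (λ x → (φ x ⊗ (1ω ⊕ ⊖ δ₁ x)) ⊕ (φ x ⊗ δ₁ x))              ≡⟨ Σω-cong p (λ x → split (φ x) (δ₁ x)) ⟩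
    ΣF φ                                                         ≡⟨ Σφ≡0 ⟩
    0ω                                                           ∎)) (⊕-identityˡ (⊖ 1ω))
    where
    1-x≢0 : ∀ x → x ≢ 1F → oneMinus p x ≢ 0F
    1-x≢0 x x≢1 1-x≡0 = x≢1 (sym (x-y≡0⇒x≡y 1F x (trans (sym (oneMinus≡1-x x)) 1-x≡0)))
    Σφδ₁≡1 : ΣF (λ x → φ x ⊗ δ₁ x) ≡ 1ω
    Σφδ₁≡1 = trans (Σω-single p _ 1F (λ x x≢1 → trans (cong (φ x ⊗_) (δ₀-≢0F _ (1-x≢0 x x≢1))) (⊗-zeroʳ (φ x))))
                   (cong₂ _⊗_ (at-one unitary-φ) (trans (cong δ₀ (trans (oneMinus≡1-x 1F) (-F‿inverseʳ 1F))) δ₀-0F))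
    split : ∀ a d → (a ⊗ (1ω ⊕ ⊖ d)) ⊕ (a ⊗ d) ≡ a
    split = solve 2 (λ a d → a :× (Κ 1ω :+ :- d) :+ a :× d := a) refl
      where open ℤω-Solver

  φχχ̄≡φ[1-δ₁][modπ] : ∀ x → φχ x ⊗ χ̄ (oneMinus p x) ≡ φ x ⊗ (1ω ⊕ ⊖ δ₁ x) [mod π ]
  φχχ̄≡φ[1-δ₁][modπ] x =
    Sum.[ (λ { refl → x≡0 }) , (λ x≢0 → Sum.[ 1-x≡0 , both≢0 x≢0 ]′ (≡0F⊎≢0F (oneMinus p x))) ]′ (≡0F⊎≢0F x)
    where
    x≡0 : φχ 0F ⊗ χ̄ (oneMinus p 0F) ≡ φ 0F ⊗ (1ω ⊕ ⊖ δ₁ 0F) [mod π ]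
    x≡0 = ≡⇒≡[mod] π (begin
      (φ 0F ⊗ χ 0F) ⊗ χ̄ (oneMinus p 0F)   ≡⟨ cong (λ t → (φ 0F ⊗ t) ⊗ χ̄ (oneMinus p 0F)) (at-zero unitary-χ) ⟩
      (φ 0F ⊗ 0ω) ⊗ χ̄ (oneMinus p 0F)     ≡⟨ trans (cong (_⊗ χ̄ (oneMinus p 0F)) (⊗-zeroʳ (φ 0F))) (⊗-zeroˡ (χ̄ (oneMinus p 0F))) ⟩
      0ω                                  ≡⟨ ⊗-zeroˡ (1ω ⊕ ⊖ δ₁ 0F) ⟨
      0ω ⊗ (1ω ⊕ ⊖ δ₁ 0F)                 ≡⟨ cong (_⊗ (1ω ⊕ ⊖ δ₁ 0F)) (at-zero unitary-φ) ⟨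
      φ 0F ⊗ (1ω ⊕ ⊖ δ₁ 0F)               ∎)
    1-x≡0 : oneMinus p x ≡ 0F → φχ x ⊗ χ̄ (oneMinus p x) ≡ φ x ⊗ (1ω ⊕ ⊖ δ₁ x) [mod π ]
    1-x≡0 1-x≡0 = ≡⇒≡[mod] π (begin
      φχ x ⊗ χ̄ (oneMinus p x)   ≡⟨ cong (λ t → φχ x ⊗ χ̄ t) 1-x≡0 ⟩
      φχ x ⊗ conj (χ 0F)        ≡⟨ cong (λ t → φχ x ⊗ conj t) (at-zero unitary-χ) ⟩
      φχ x ⊗ 0ω                 ≡⟨ ⊗-zeroʳ (φχ x) ⟩
      0ω                        ≡⟨ ⊗-zeroʳ (φ x) ⟨
      φ x ⊗ (1ω ⊕ ⊖ 1ω)         ≡⟨ cong (λ t → φ x ⊗ (1ω ⊕ ⊖ t)) δ₀-0F ⟨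
      φ x ⊗ (1ω ⊕ ⊖ δ₀ 0F)      ≡⟨ cong (λ t → φ x ⊗ (1ω ⊕ ⊖ δ₀ t)) 1-x≡0 ⟨
      φ x ⊗ (1ω ⊕ ⊖ δ₁ x)       ∎)
    both≢0 : x ≢ 0F → oneMinus p x ≢ 0F → φχ x ⊗ χ̄ (oneMinus p x) ≡ φ x ⊗ (1ω ⊕ ⊖ δ₁ x) [mod π ]
    both≢0 x≢0 1-x≢0 = subst₂ (λ s t → s ≡ t [mod π ]) refl φ⊗1⊗1≡
      ([mod]-⊗ ([mod]-⊗ (≡⇒≡[mod] {φ x} π refl) (z³≡1⇒z≡1[modπ] (χ x) (χ³≡1 x x≢0)))
               (z³≡1⇒z≡1[modπ] (χ̄ (oneMinus p x)) χ̄³≡1))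
      where
      χ̄³≡1 : χ̄ (oneMinus p x) ^ω 3 ≡ 1ω
      χ̄³≡1 = trans (sym (conj-^ω (χ (oneMinus p x)) 3)) (cong conj (χ³≡1 (oneMinus p x) 1-x≢0))
      φ⊗1⊗1≡ : (φ x ⊗ 1ω) ⊗ 1ω ≡ φ x ⊗ (1ω ⊕ ⊖ δ₁ x)
      φ⊗1⊗1≡ = begin
        (φ x ⊗ 1ω) ⊗ 1ω            ≡⟨ ⊗-identityʳ (φ x ⊗ 1ω) ⟩
        φ x ⊗ 1ω                   ≡⟨ cong (λ t → φ x ⊗ (1ω ⊕ ⊖ t)) (δ₀-≢0F _ 1-x≢0) ⟨
        φ x ⊗ (1ω ⊕ ⊖ δ₁ x)        ∎

  Jφχ≡-1[modπ] : Jφχ ≡ ⊖ 1ω [mod π ]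
  Jφχ≡-1[modπ] = subst (λ t → Jφχ ≡ t [mod π ]) Σφ[1-δ₁]≡-1 (Σω-cong-mod p π φχχ̄≡φ[1-δ₁][modπ])

  Jφχ≡a+2wω : ∀ w → ℤω.b Jφχ ≡ + 2 * w → Jφχ ≡ ℤω.a Jφχ + (+ 2 * w) ω
  Jφχ≡a+2wω w bJφχ≡2w = cong (λ v → ℤω.a Jφχ + v ω) bJφχ≡2w

  p≡X²+3w² : ∀ w → ℤω.b Jφχ ≡ + 2 * w → + p ≡ (ℤω.a Jφχ - w) * (ℤω.a Jφχ - w) + + 3 * (w * w)
  p≡X²+3w² w bJφχ≡2w = begin
    + p                         ≡⟨ cong ℤω.a |Jφχ|²≡p ⟨
    ℤω.a (conj Jφχ ⊗ Jφχ)           ≡⟨ cong ℤω.a (conj⊗self≡norm Jφχ) ⟩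
    norm Jφχ                      ≡⟨ cong norm (Jφχ≡a+2wω w bJφχ≡2w) ⟩
    norm (ℤω.a Jφχ + (+ 2 * w) ω) ≡⟨ norm-primary (ℤω.a Jφχ) w ⟩
    (ℤω.a Jφχ - w) * (ℤω.a Jφχ - w) + + 3 * (w * w) ∎

  p*ReBinoms≡X-1 : ∀ w → ℤω.b Jφχ ≡ + 2 * w →
    (+ p ℚ./ 1) ℚ.* (ReBinom p χ χ ℚ.+ ReBinom p φχ χ) ≡ ι (ℤω.a Jφχ - w - + 1)
  p*ReBinoms≡X-1 w bJφχ≡2w = begin
    P ℚ.* (ReBinom p χ χ ℚ.+ ReBinom p φχ χ)
      ≡⟨ cong₂ (λ s t → P ℚ.* (Re (ℤω.a s ℚ./ p) (ℤω.b s ℚ./ p) ℚ.+ Re (ℤω.a t ℚ./ p) (ℤω.b t ℚ./ p)))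
               pBinom-χ-χ≡-1 (trans pBinom-φχ-χ≡Jφχ (Jφχ≡a+2wω w bJφχ≡2w)) ⟩
    P ℚ.* (Re (-[1+ 0 ] ℚ./ p) (+ 2 * + 0 ℚ./ p) ℚ.+ Re (ℤω.a Jφχ ℚ./ p) (+ 2 * w ℚ./ p))
      ≡⟨ ℚ.*-distribˡ-+ P _ _ ⟩
    P ℚ.* Re (-[1+ 0 ] ℚ./ p) (+ 2 * + 0 ℚ./ p) ℚ.+ P ℚ.* Re (ℤω.a Jφχ ℚ./ p) (+ 2 * w ℚ./ p)
      ≡⟨ cong₂ ℚ._+_ (p*Re≡u-w p -[1+ 0 ] (+ 0)) (p*Re≡u-w p (ℤω.a Jφχ) w) ⟩
    ι (-[1+ 0 ] - + 0) ℚ.+ ι (ℤω.a Jφχ - w)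
      ≡⟨ ι-+ (-[1+ 0 ] - + 0) (ℤω.a Jφχ - w) ⟩
    ι (-[1+ 0 ] - + 0 + (ℤω.a Jφχ - w))
      ≡⟨ cong ι (reorder (ℤω.a Jφχ - w)) ⟩
    ι (ℤω.a Jφχ - w - + 1) ∎
    where
    P = + p ℚ./ 1
    reorder : ∀ X → -[1+ 0 ] - + 0 + X ≡ X - + 1
    reorder = ℤ-Solver.solve-∀

-- Representations p = x² + 3y²

residue-unique : ∀ {r r′} k → r ℕ.< 3 → r′ ℕ.< 3 → + r - + r′ ≡ + 3 * k → r ≡ r′
residue-unique {r} {r′} k r<3 r′<3 r-r′≡3k =
  ℤ.+-injective (ℤ.i-j≡0⇒i≡j (+ r) (+ r′) (trans r-r′≡3k (cong (+ 3 *_) k≡0)))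
  where
  ∣3k∣<3 : ∣ + 3 * k ∣ ℕ.< 3
  ∣3k∣<3 = subst (λ i → ∣ i ∣ ℕ.< 3) (trans (sym (ℤ.[+m]-[+n]≡m⊖n r r′)) r-r′≡3k)
             (ℕ.≤-<-trans (ℤ.∣m⊝n∣≤m⊔n r r′) (ℕ.⊔-lub r<3 r′<3))
  k≡0 : k ≡ + 0
  k≡0 = ℤ.∣i∣≡0⇒i≡0 (ℕ.n<1⇒n≡0 (ℕ.*-cancelˡ-< 3 ∣ k ∣ 1 (subst (ℕ._< 3) (ℤ.abs-* (+ 3) k) ∣3k∣<3)))

i≡r+3t⇒i%ℕ3≡r : ∀ i {r} t → r ℕ.< 3 → i ≡ + r + + 3 * t → i %ℕ 3 ≡ r
i≡r+3t⇒i%ℕ3≡r i {r} t r<3 i≡r+3t = residue-unique (t - i /ℕ 3) (n%ℕd<d i 3) r<3 (begin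
  + (i %ℕ 3) - + r                                          ≡⟨ identity (+ (i %ℕ 3)) (i /ℕ 3) (+ r) t ⟩
  (+ (i %ℕ 3) + i /ℕ 3 * + 3) - (+ r + + 3 * t) + + 3 * (t - i /ℕ 3)
                                                            ≡⟨ cong₂ (λ a b → a - b + + 3 * (t - i /ℕ 3)) (a≡a%ℕn+[a/ℕn]*n i 3) i≡r+3t ⟨
  i - i + + 3 * (t - i /ℕ 3)                                ≡⟨ cong (_+ + 3 * (t - i /ℕ 3)) (ℤ.+-inverseʳ i) ⟩
  + 0 + + 3 * (t - i /ℕ 3)                                  ≡⟨ ℤ.+-identityˡ _ ⟩
  + 3 * (t - i /ℕ 3)                                        ∎)
  where
  open ≡-Reasoning
  identity : ∀ s q r t → s - r ≡ (s + q * + 3) - (r + + 3 * t) + + 3 * (t - q)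
  identity = ℤ-Solver.solve-∀

legendre3≡1 : ∀ x → x %ℕ 3 ≡ 1 → legendre3 x ≡ + 1
legendre3≡1 x x%3≡1 rewrite x%3≡1 = refl

legendre3≡-1 : ∀ x → x %ℕ 3 ≡ 2 → legendre3 x ≡ - + 1
legendre3≡-1 x x%3≡2 rewrite x%3≡2 = refl

signPow-odd : ∀ n → ∣ n ∣ % 2 ≡ 1 → signPow n ≡ - + 1
signPow-odd n ∣n∣%2≡1 rewrite ∣n∣%2≡1 = refl

i*i≡j*j⇒i≡j∨i≡-j : ∀ i j → i * i ≡ j * j → i ≡ j ⊎ i ≡ - j
i*i≡j*j⇒i≡j∨i≡-j i j i²≡j² = Sum.map (ℤ.i-j≡0⇒i≡j i j) (λ i+j≡0 → ℤ.i-j≡0⇒i≡j i (- j) (trans (cong (λ t → i + t) (ℤ.neg-involutive j)) i+j≡0))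
  (ℤ.i*j≡0⇒i≡0∨j≡0 (i - j) (trans (factor i j) (ℤ.i≡j⇒i-j≡0 i²≡j²)))
  where
  factor : ∀ i j → (i - j) * (i + j) ≡ i * i - j * j
  factor = ℤ-Solver.solve-∀

-- a nonzero multiple m of p has 3m² ≥ 3p² > p²
p∣m⇒m≡0 : ∀ {p} .{{_ : ℕ.NonZero p}} q m → q * q + + 3 * (m * m) ≡ + p * + p → p ∣ ∣ m ∣ → m ≡ + 0
p∣m⇒m≡0 q m _ (divides zero ∣m∣≡0) = ℤ.∣i∣≡0⇒i≡0 ∣m∣≡0
p∣m⇒m≡0 {p} q m q²+3m²≡p² (divides (suc k) ∣m∣≡[1+k]p) = ⊥-elim (ℕ.<⇒≱ p²<3p² 3p²≤p²)
  where
  instance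
    p²≢0 : ℕ.NonZero (p ℕ.* p)
    p²≢0 = ℕ.m*n≢0 p p
  Q M : ℕ
  Q = ∣ q ∣ ℕ.* ∣ q ∣
  M = ∣ m ∣ ℕ.* ∣ m ∣
  Q+3M≡p² : Q ℕ.+ 3 ℕ.* M ≡ p ℕ.* p
  Q+3M≡p² = ℤ.+-injective (begin
    + (Q ℕ.+ 3 ℕ.* M)         ≡⟨ cong₂ _+_ (i*i≡∣i∣*∣i∣ q) (trans (cong (+ 3 *_) (i*i≡∣i∣*∣i∣ m)) (sym (ℤ.pos-* 3 M))) ⟨
    q * q + + 3 * (m * m)     ≡⟨ q²+3m²≡p² ⟩
    + p * + p                 ≡⟨ ℤ.pos-* p p ⟨
    + (p ℕ.* p)               ∎)
    where open ≡-Reasoning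
  p≤∣m∣ : p ℕ.≤ ∣ m ∣
  p≤∣m∣ = subst (p ℕ.≤_) (sym ∣m∣≡[1+k]p) (ℕ.m≤m+n p (k ℕ.* p))
  p²<3p² : p ℕ.* p ℕ.< 3 ℕ.* (p ℕ.* p)
  p²<3p² = subst (p ℕ.* p ℕ.<_) (ℕ.*-comm (p ℕ.* p) 3) (ℕ.m<m*n (p ℕ.* p) 3 (ℕ.s≤s (ℕ.s≤s ℕ.z≤n)))
  3p²≤p² : 3 ℕ.* (p ℕ.* p) ℕ.≤ p ℕ.* p
  3p²≤p² = ℕ.≤-trans (ℕ.*-monoʳ-≤ 3 (ℕ.*-mono-≤ p≤∣m∣ p≤∣m∣))
                     (ℕ.≤-trans (ℕ.m≤n+m (3 ℕ.* M) Q) (ℕ.≤-reflexive Q+3M≡p²))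

module _ {p} (p-prime : Prime p) (a b c d : ℤ)
         (p≡a²+3b² : + p ≡ a * a + + 3 * (b * b)) (p≡c²+3d² : + p ≡ c * c + + 3 * (d * d)) where

  private
    instance
      p≢0 : ℕ.NonZero p
      p≢0 = prime⇒nonZero p-prime

  [ad-bc][ad+bc]≡p[d²-b²] : (a * d - b * c) * (a * d + b * c) ≡ + p * (d * d - b * b)
  [ad-bc][ad+bc]≡p[d²-b²] = begin
    (a * d - b * c) * (a * d + b * c)                                      ≡⟨ expand a b c d ⟩
    (a * a + + 3 * (b * b)) * (d * d) - (c * c + + 3 * (d * d)) * (b * b)  ≡⟨ cong₂ (λ s t → s * (d * d) - t * (b * b)) (sym p≡a²+3b²) (sym p≡c²+3d²) ⟩
    + p * (d * d) - + p * (b * b)                                          ≡⟨ factor (+ p) (d * d) (b * b) ⟩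
    + p * (d * d - b * b)                                                  ∎
    where
    open ≡-Reasoning
    expand : ∀ a b c d → (a * d - b * c) * (a * d + b * c)
                       ≡ (a * a + + 3 * (b * b)) * (d * d) - (c * c + + 3 * (d * d)) * (b * b)
    expand = ℤ-Solver.solve-∀
    factor : ∀ P u v → P * u - P * v ≡ P * (u - v)
    factor = ℤ-Solver.solve-∀

  -- p divides ad - bc or ad + bc, and (ac ± 3bd)² + 3(ad ∓ bc)² = (a² + 3b²)(c² + 3d²) = p²
  ad-bc≡0⊎ad+bc≡0 : a * d - b * c ≡ + 0 ⊎ a * d + b * c ≡ + 0
  ad-bc≡0⊎ad+bc≡0 = Sum.map (p∣m⇒m≡0 (a * c + + 3 * (b * d)) (a * d - b * c) composition₁)
                            (p∣m⇒m≡0 (a * c - + 3 * (b * d)) (a * d + b * c) composition₂)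
                            (euclidsLemma ∣ a * d - b * c ∣ ∣ a * d + b * c ∣ p-prime p∣product)
    where
    open ≡-Reasoning
    p∣product : p ∣ ∣ a * d - b * c ∣ ℕ.* ∣ a * d + b * c ∣
    p∣product = divides ∣ d * d - b * b ∣ (begin
      ∣ a * d - b * c ∣ ℕ.* ∣ a * d + b * c ∣   ≡⟨ ℤ.abs-* (a * d - b * c) (a * d + b * c) ⟨
      ∣ (a * d - b * c) * (a * d + b * c) ∣     ≡⟨ cong ∣_∣ [ad-bc][ad+bc]≡p[d²-b²] ⟩
      ∣ + p * (d * d - b * b) ∣                 ≡⟨ ℤ.abs-* (+ p) (d * d - b * b) ⟩
      p ℕ.* ∣ d * d - b * b ∣                   ≡⟨ ℕ.*-comm p _ ⟩
      ∣ d * d - b * b ∣ ℕ.* p                   ∎)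
    composition₁ : (a * c + + 3 * (b * d)) * (a * c + + 3 * (b * d)) + + 3 * ((a * d - b * c) * (a * d - b * c)) ≡ + p * + p
    composition₁ = trans (identity a b c d) (cong₂ _*_ (sym p≡a²+3b²) (sym p≡c²+3d²))
      where
      identity : ∀ a b c d → (a * c + + 3 * (b * d)) * (a * c + + 3 * (b * d)) + + 3 * ((a * d - b * c) * (a * d - b * c))
                           ≡ (a * a + + 3 * (b * b)) * (c * c + + 3 * (d * d))
      identity = ℤ-Solver.solve-∀
    composition₂ : (a * c - + 3 * (b * d)) * (a * c - + 3 * (b * d)) + + 3 * ((a * d + b * c) * (a * d + b * c)) ≡ + p * + p
    composition₂ = trans (identity a b c d) (cong₂ _*_ (sym p≡a²+3b²) (sym p≡c²+3d²))
      where
      identity : ∀ a b c d → (a * c - + 3 * (b * d)) * (a * c - + 3 * (b * d)) + + 3 * ((a * d + b * c) * (a * d + b * c))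
                           ≡ (a * a + + 3 * (b * b)) * (c * c + + 3 * (d * d))
      identity = ℤ-Solver.solve-∀

  x²+3y²-unique : a * a ≡ c * c
  x²+3y²-unique = begin
    a * a                                                              ≡⟨ identity a b c d ⟩
    (a * a + + 3 * (b * b)) + + 3 * (d * d - b * b) - + 3 * (d * d)    ≡⟨ cong₂ (λ s t → s + + 3 * t - + 3 * (d * d)) (trans (sym p≡a²+3b²) p≡c²+3d²) d²-b²≡0 ⟩
    (c * c + + 3 * (d * d)) + + 3 * + 0 - + 3 * (d * d)                ≡⟨ cancel c d ⟩
    c * c                                                              ∎
    where
    open ≡-Reasoning
    identity : ∀ a b c d → a * a ≡ (a * a + + 3 * (b * b)) + + 3 * (d * d - b * b) - + 3 * (d * d)
    identity = ℤ-Solver.solve-∀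
    cancel : ∀ c d → (c * c + + 3 * (d * d)) + + 3 * + 0 - + 3 * (d * d) ≡ c * c
    cancel = ℤ-Solver.solve-∀
    product≡0 : (a * d - b * c) * (a * d + b * c) ≡ + 0
    product≡0 = Sum.[ (λ m₁≡0 → cong (_* (a * d + b * c)) m₁≡0)
                    , (λ m₂≡0 → trans (cong ((a * d - b * c) *_) m₂≡0) (ℤ.*-zeroʳ (a * d - b * c))) ]′ ad-bc≡0⊎ad+bc≡0
    d²-b²≡0 : d * d - b * b ≡ + 0
    d²-b²≡0 = Sum.[ (λ p≡0 → ⊥-elim (ℕ.≢-nonZero⁻¹ p (ℤ.+-injective p≡0))) , id ]′
                (ℤ.i*j≡0⇒i≡0∨j≡0 (+ p) (trans (sym [ad-bc][ad+bc]≡p[d²-b²]) product≡0))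

-- x² + 3y² = (x + y)² + 2(y² - xy), so x + y even would make p even
x+y-odd : ∀ {p} x y → Prime p → p % 3 ≡ 1 → + p ≡ x * x + + 3 * (y * y) → ∣ x + y ∣ % 2 ≡ 1
x+y-odd {p} x y p-prime p%3≡1 p≡x²+3y² with ∣ x + y ∣ % 2 | m%n<n ∣ x + y ∣ 2 | m≡m%n+[m/n]*n ∣ x + y ∣ 2
... | 1 | _ | _ = refl
... | suc (suc _) | ℕ.s≤s (ℕ.s≤s ()) | _
... | zero | _ | ∣x+y∣≡k*2 = ⊥-elim (2≢p (Sum.[ (λ ()) , id ]′ (prime⇒irreducible p-prime 2∣p)))
  where
  k = ∣ x + y ∣ ℕ./ 2
  [x+y]²≡4k² : (x + y) * (x + y) ≡ + 4 * + (k ℕ.* k)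
  [x+y]²≡4k² = begin
    (x + y) * (x + y)                      ≡⟨ i*i≡∣i∣*∣i∣ (x + y) ⟩
    + (∣ x + y ∣ ℕ.* ∣ x + y ∣)            ≡⟨ cong (λ n → + (n ℕ.* n)) ∣x+y∣≡k*2 ⟩
    + (k ℕ.* 2 ℕ.* (k ℕ.* 2))              ≡⟨ cong +_ (square k) ⟩
    + (4 ℕ.* (k ℕ.* k))                    ≡⟨ ℤ.pos-* 4 (k ℕ.* k) ⟩
    + 4 * + (k ℕ.* k)                      ∎
    where
    open ≡-Reasoning
    square : ∀ k → k ℕ.* 2 ℕ.* (k ℕ.* 2) ≡ 4 ℕ.* (k ℕ.* k)
    square = ℕ-Solver.solve-∀
  z : ℤ
  z = + 2 * + (k ℕ.* k) + (y * y - x * y)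
  p≡2z : + p ≡ + 2 * z
  p≡2z = begin
    + p                                       ≡⟨ p≡x²+3y² ⟩
    x * x + + 3 * (y * y)                     ≡⟨ identity x y ⟩
    (x + y) * (x + y) + + 2 * (y * y - x * y) ≡⟨ cong (_+ + 2 * (y * y - x * y)) [x+y]²≡4k² ⟩
    + 4 * + (k ℕ.* k) + + 2 * (y * y - x * y) ≡⟨ factor (+ (k ℕ.* k)) (y * y - x * y) ⟩
    + 2 * z                                   ∎
    where
    open ≡-Reasoning
    identity : ∀ x y → x * x + + 3 * (y * y) ≡ (x + y) * (x + y) + + 2 * (y * y - x * y)
    identity = ℤ-Solver.solve-∀
    factor : ∀ K w → + 4 * K + + 2 * w ≡ + 2 * (+ 2 * K + w)
    factor = ℤ-Solver.solve-∀
  2∣p : 2 ∣ p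
  2∣p = divides ∣ z ∣ (trans (cong ∣_∣ p≡2z) (trans (ℤ.abs-* (+ 2) z) (ℕ.*-comm 2 ∣ z ∣)))
  2≢p : 2 ≢ p
  2≢p 2≡p with trans (cong (_% 3) 2≡p) p%3≡1
  ... | ()

signPow*legendre3*x≡X : ∀ {p} x y X Y t → Prime p → p % 3 ≡ 1 →
  + p ≡ x * x + + 3 * (y * y) → + p ≡ X * X + + 3 * (Y * Y) → X ≡ -[1+ 0 ] + + 3 * t →
  signPow (x + y) * legendre3 x * x ≡ X
signPow*legendre3*x≡X {p} x y X Y t p-prime p%3≡1 p≡x²+3y² p≡X²+3Y² X≡-1+3t =
  Sum.[ x≡X , x≡-X ]′ (i*i≡j*j⇒i≡j∨i≡-j x X (x²+3y²-unique p-prime x y X Y p≡x²+3y² p≡X²+3Y²))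
  where
  open ≡-Reasoning
  signPow[x+y]≡-1 : signPow (x + y) ≡ - + 1
  signPow[x+y]≡-1 = signPow-odd (x + y) (x+y-odd x y p-prime p%3≡1 p≡x²+3y²)
  x≡X : x ≡ X → signPow (x + y) * legendre3 x * x ≡ X
  x≡X refl = begin
    signPow (x + y) * legendre3 x * x     ≡⟨ cong₂ (λ s l → s * l * x) signPow[x+y]≡-1 (legendre3≡-1 x x%3≡2) ⟩
    - + 1 * - + 1 * x                     ≡⟨ ℤ.*-identityˡ x ⟩
    x                                     ∎
    where
    x%3≡2 : x %ℕ 3 ≡ 2
    x%3≡2 = i≡r+3t⇒i%ℕ3≡r x (t - + 1) (ℕ.s≤s (ℕ.s≤s (ℕ.s≤s ℕ.z≤n))) (trans X≡-1+3t (shift t))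
      where
      shift : ∀ t → -[1+ 0 ] + + 3 * t ≡ + 2 + + 3 * (t - + 1)
      shift = ℤ-Solver.solve-∀
  x≡-X : x ≡ - X → signPow (x + y) * legendre3 x * x ≡ X
  x≡-X refl = begin
    signPow (- X + y) * legendre3 (- X) * - X  ≡⟨ cong₂ (λ s l → s * l * - X) signPow[x+y]≡-1 (legendre3≡1 (- X) -X%3≡1) ⟩
    - + 1 * + 1 * - X                          ≡⟨ sign-cancels X ⟩
    X                                          ∎
    where
    sign-cancels : ∀ X → - + 1 * + 1 * - X ≡ X
    sign-cancels = ℤ-Solver.solve-∀
    -X%3≡1 : (- X) %ℕ 3 ≡ 1
    -X%3≡1 = i≡r+3t⇒i%ℕ3≡r (- X) (- t) (ℕ.s≤s (ℕ.s≤s ℕ.z≤n)) (trans (cong -_ X≡-1+3t) (negate t))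
      where
      negate : ∀ t → - (-[1+ 0 ] + + 3 * t) ≡ + 1 + + 3 * (- t)
      negate = ℤ-Solver.solve-∀

corollary4 : (p : ℕ) .{{_ : NonZero p}} → Prime p → p % 3 ≡ 1 →
    (x y : ℤ) → + p ≡ x ℤ.* x ℤ.+ (+ 3) ℤ.* (y ℤ.* y) →
    (χ φ : Fin p → ℤω) → IsCharacterOfOrder p 3 χ → IsCharacterOfOrder p 2 φ →
    ℚ._*_ (ℚ._/_ (+ p) 1) (ReBinom p χ χ ℚ.+ ReBinom p (φ ·χ χ) χ)
      ≡ ℚ._/_ (signPow (x ℤ.+ y) ℤ.* legendre3 x ℤ.* x ℤ.- (+ 1)) 1
corollary4 p p-prime p%3≡1 x y p≡x²+3y² χ φ order₃ order₂ =
  let open CubicJacobiSums p p-prime order₃ order₂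
      (w , t , bJφχ≡2w , X≡-1+3t) = primary-coordinates Jφχ≡-1[mod2] Jφχ≡-1[modπ]
      X = ℤω.a Jφχ ℤ.- w
  in begin
    ℚ._*_ (ℚ._/_ (+ p) 1) (ReBinom p χ χ ℚ.+ ReBinom p (φ ·χ χ) χ)
      ≡⟨ p*ReBinoms≡X-1 w bJφχ≡2w ⟩
    ι (X ℤ.- + 1)
      ≡⟨ cong (λ n → ι (n ℤ.- + 1))
              (signPow*legendre3*x≡X x y X w t p-prime p%3≡1 p≡x²+3y² (p≡X²+3w² w bJφχ≡2w) X≡-1+3t) ⟨
    ℚ._/_ (signPow (x ℤ.+ y) ℤ.* legendre3 x ℤ.* x ℤ.- (+ 1)) 1
      ∎
  where open ≡-Reasoning
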